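{- Let $k$ be a positive integer. An incidence graph $\mathcal{J}$ has strict hypertree depth at most $k$ if and only if there exists a label-free $k$-labeled incidence graph $L\in\mathsf{GLI}^k$ whose skeleton $\mathcal{I}_L$ is isomorphic to $\mathcal{J}$.
   Context: An incidence graph is $\mathcal{I}=(R(\mathcal{I}),B(\mathcal{I}),E(\mathcal{I}))$ with disjoint finite sets of red and blue vertices and $E(\mathcal{I})\subseteq B(\mathcal{I})\times R(\mathcal{I})$, every red vertex having a blue neighbour; $\beta(e)$ is the set of red neighbours of blue $e$. Isomorphism means bijections on red and on blue vertices preserving and reflecting edges. Strict hypertree depth: for a rooted forest $F$, $\le_F$ is the tree order (roots minimal), $P(s)$ the node set of the path from $s$ to its root, $\mathrm{lcv}(s,t)$ the $\le_F$-maximum of $P(s)\cap P(t)$ (defined iff $s,t$ are in the same tree), height = max $|P(s)|$. A strict elimination forest of $\mathcal{I}$ is $(F,\Gamma)$ with $\Gamma\colon V(F)\to B(\mathcal{I})$ bijective such that, with $\hat\Gamma(t)=\beta(\Gamma(t))$, whenever $\hat\Gamma(s)\cap\hat\Gamma(t)\ne\emptyset$, $\mathrm{lcv}(s,t)$ is defined and $\hat\Gamma(s)\cap\hat\Gamma(t)\subseteq\bigcup_{p\in P(\mathrm{lcv}(s,t))}\hat\Gamma(p)$. $\mathrm{shd}(\mathcal{I})$ is the minimum height of such a forest. $k$-labeled incidence graphs: $L=(\mathcal{I},r,b,g)$ where $\mathcal{I}$ (the skeleton $\mathcal{I}_L$) is an incidence graph, $r$ is a partial map from positive integers to $R(\mathcal{I})$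 with finite domain, $b$ a partial map $\{1,\dots,k\}\rightharpoonup B(\mathcal{I})$, and $g$ a partial map from positive integers to $\{1,\dots,k\}$ with $\mathrm{dom}(g)=\mathrm{dom}(r)$. $L$ has real guards if for all $i\in\mathrm{dom}(r)$: $g(i)\in\mathrm{dom}(b)$ and $(b(g(i)),r(i))\in E(\mathcal{I})$. $L$ is label-free if $r,b,g$ are empty. Two partial maps are compatible if they agree on their common domain; $f\cup h$ means $f$ on $\mathrm{dom}(f)$ and $h$ elsewhere on $\mathrm{dom}(h)$. Operations: (i) for $X_r\subseteq\mathrm{dom}(r)$, removing red labels $X_r$ restricts $r$ and $g$ to $\mathrm{dom}(r)\setminus X_r$; (ii) for $X_b\subseteq\{1,\dots,k\}$, removing blue labels $X_b$ restricts $b$ to $\mathrm{dom}(b)\setminus X_b$; (iii) glueing $L_1\cdot L_2$: take the disjoint union of the skeletons, identify (transitively) $r_1(j)$ with $r_2(j)$ for all $j\in\mathrm{dom}(r_1)\cap\mathrm{dom}(r_2)$ and $b_1(j)$ with $b_2(j)$ for all $j\in\mathrm{dom}(b_1)\cap\mathrm{dom}(b_2)$ (merged vertices inherit all incidences), and let $r$, $b$ be the induced label maps on $\mathrm{dom}(r_1)\cup\mathrm{dom}(r_2)$, $\mathrm{dom}(b_1)\cup\mathrm{dom}(b_2)$ and $g=g_1\cup g_2$; (iv) a transition for $L$ is a partial map $f$ from positive integers to $\{1,\dots,k\}$ with $\emptyset\ne\mathrm{dom}(f)\subseteq\mathrm{dom}(g)$ such that every $i\in\mathrm{dom}(g)$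 with $g(i)\in\mathrm{img}(f)$ lies in $\mathrm{dom}(f)$. $M_f$ is the $k$-labeled incidence graph with a red vertex $v_i$ for each $i\in\mathrm{dom}(f)$, a blue vertex $e_j$ for each $j\in\mathrm{img}(f)$, edges $(e_{f(i)},v_i)$, $r(i)=v_i$, $b(j)=e_j$, $g=f$. Applying $f$ gives $L[f]:=M_f\cdot L'$ where $L'$ is $L$ with the blue labels $X_b=\mathrm{img}(g)\cap\mathrm{img}(f)\cap\mathrm{dom}(b)$ removed. Classes $\mathsf{GLI}_k^i$ ($i\in\mathbb{N}$) are the smallest sets satisfying: (base) every $k$-labeled incidence graph with real guards in which every red and every blue vertex carries a label ($\mathrm{img}(r)=R(\mathcal{I})$, $\mathrm{img}(b)=B(\mathcal{I})$) is in $\mathsf{GLI}_k^0$; $\mathsf{GLI}_k^i\subseteq\mathsf{GLI}_k^{i+1}$; (glueing) if $L_1\in\mathsf{GLI}_k^{i_1}$, $L_2\in\mathsf{GLI}_k^{i_2}$ have compatible guard functions then $L_1\cdot L_2\in\mathsf{GLI}_k^{\max(i_1,i_2)}$; (transition) if $L\in\mathsf{GLI}_k^i$ and $f$ is a transition for $L$ then $L[f]\in\mathsf{GLI}_k^{i+|\mathrm{img}(f)\cap\mathrm{dom}(b_L)\cap\mathrm{img}(g_L)|}$; (red removal) if $L\in\mathsf{GLI}_k^i$ and $X_r\subseteq\mathrm{dom}(r)$ then $L$ with red labels $X_r$ removed is in $\mathsf{GLI}_k^i$; (blue removal) if $L\in\mathsf{GLI}_k^i$ and $X_b\subseteq\mathrm{dom}(b)\setminus\mathrm{img}(g)$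 then $L$ with blue labels $X_b$ removed is in $\mathsf{GLI}_k^{i+|X_b|}$. Finally $\mathsf{GLI}^k:=\mathsf{GLI}_k^k$. -}

module Defs where

open import Data.Nat using (ℕ; zero; suc; _+_; _≤_; _⊔_)
open import Data.Fin using (Fin; zero; suc)
open import Data.Bool using (Bool; true; false; if_then_else_)
open import Data.Maybe using (Maybe; just; nothing; is-just; _<∣>_)
import Data.Maybe as Maybe
open import Data.Product using (Σ; ∃; ∃-syntax; _×_; _,_)
open import Data.Sum using (_⊎_; inj₁; inj₂; [_,_]′)
open import Relation.Binary.PropositionalEquality using (_≡_)
open import Relation.Nullary using (¬_)
open import Function.Bundles using (_⇔_; _⤖_; Bijection)
open import Induction.WellFounded using (WellFounded)
open import Relation.Binary.Construct.Closure.Equivalence using (EqClosure)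

record IG : Set where
  field
    nR nB   : ℕ
    E       : Fin nB → Fin nR → Bool
    covered : ∀ v → ∃[ e ] (E e v ≡ true)
open IG public

record Iso (I J : IG) : Set where
  field
    φR : Fin (nR I) ⤖ Fin (nR J)
    φB : Fin (nB I) ⤖ Fin (nB J)
    edges : ∀ e v → E I e v ≡ E J (Bijection.to φB e) (Bijection.to φR v)

record Forest (n : ℕ) : Set where
  field
    parent : Fin n → Maybe (Fin n)
    wf     : WellFounded (λ p s → parent s ≡ just p)
open Forest public

-- Anc F p s : p ≤_F s, i.e. p ∈ P(s) (p lies on the path from s to its root)
data Anc {n : ℕ} (F : Forest n) : Fin n → Fin n → Set where
  here  : ∀ {s} → Anc F s s
  there : ∀ {p q s} → parent F s ≡ just q → Anc F p q → Anc F p s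

-- PathLen F s m : |P(s)| = m (number of nodes on the path from s to its root)
data PathLen {n : ℕ} (F : Forest n) : Fin n → ℕ → Set where
  root : ∀ {s} → parent F s ≡ nothing → PathLen F s 1
  step : ∀ {s p m} → parent F s ≡ just p → PathLen F p m → PathLen F s (suc m)

HeightAtMost : ∀ {n} → Forest n → ℕ → Set
HeightAtMost F h = ∀ s m → PathLen F s m → m ≤ h

IsLcv : ∀ {n} → Forest n → Fin n → Fin n → Fin n → Set
IsLcv F s t c = Anc F c s × Anc F c t × (∀ d → Anc F d s → Anc F d t → Anc F d c)

record StrictElimForest (I : IG) : Set where
  field
    nF : ℕ
    F  : Forest nF
    Γ  : Fin nF ⤖ Fin (nB I)
  InΓ̂ : Fin nF → Fin (nR I) → Set
  InΓ̂ t v = E I (Bijection.to Γ t) v ≡ true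
  field
    strict : ∀ s t v → InΓ̂ s v → InΓ̂ t v →
             ∃[ c ] (IsLcv F s t c ×
                     (∀ w → InΓ̂ s w → InΓ̂ t w → ∃[ p ] (Anc F p c × InΓ̂ p w)))

shd≤ : IG → ℕ → Set
shd≤ I h = Σ (StrictElimForest I) (λ SF → HeightAtMost (StrictElimForest.F SF) h)

-- k-labeled incidence graphs.
-- Red labels (positive integers) are represented by ℕ (label i+1 ↦ i);
-- blue labels {1,…,k} by Fin k.  Partial maps are functions into Maybe.

record LIG (k : ℕ) : Set where
  field
    G     : IG
    r     : ℕ → Maybe (Fin (nR G))
    b     : Fin k → Maybe (Fin (nB G))
    g     : ℕ → Maybe (Fin k)
    domEq : ∀ i → is-just (r i) ≡ is-just (g i)
    fin   : ∃[ N ] (∀ i → N ≤ i → r i ≡ nothing)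
open LIG public

InImg : ∀ {A : Set} → (ℕ → Maybe A) → A → Set
InImg f a = ∃[ i ] (f i ≡ just a)

InDom : ∀ {A B : Set} → (A → Maybe B) → A → Set
InDom f a = is-just (f a) ≡ true

RealGuards : ∀ {k} → LIG k → Set
RealGuards L = ∀ i v → r L i ≡ just v →
  ∃[ j ] (g L i ≡ just j × ∃[ e ] (b L j ≡ just e × E (G L) e v ≡ true))

LabelFree : ∀ {k} → LIG k → Set
LabelFree L = (∀ i → r L i ≡ nothing) × (∀ j → b L j ≡ nothing) × (∀ i → g L i ≡ nothing)

Compatible : ∀ {A : Set} → (ℕ → Maybe A) → (ℕ → Maybe A) → Set
Compatible f h = ∀ i a c → f i ≡ just a → h i ≡ just c → a ≡ c

card : ∀ {k} → (Fin k → Bool) → ℕ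
card {zero}  S = 0
card {suc k} S = (if S zero then 1 else 0) + card (λ j → S (suc j))

-- removing red labels X (X ⊆ dom r is required where used)
removeRed : ∀ {k} → LIG k → (ℕ → Bool) → LIG k
removeRed L X = record
  { G = G L
  ; r = λ i → if X i then nothing else r L i
  ; b = b L
  ; g = λ i → if X i then nothing else g L i
  ; domEq = λ i → lemma (X i) i
  ; fin = finR (fin L)
  }
  where
  lemma : ∀ x i → is-just (if x then nothing else r L i) ≡ is-just (if x then nothing else g L i)
  lemma true  i = _≡_.refl
  lemma false i = domEq L i
  finR : (∃[ N ] (∀ i → N ≤ i → r L i ≡ nothing)) →
         ∃[ N ] (∀ i → N ≤ i → (if X i then nothing else r L i) ≡ nothing)
  finR (N , h) = N , λ i le → go (X i) i le
    where
    go : ∀ x i → N ≤ i → (if x then nothing else r L i) ≡ nothing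
    go true  i le = _≡_.refl
    go false i le = h i le

removeBlue : ∀ {k} → LIG k → (Fin k → Bool) → LIG k
removeBlue L X = record
  { G = G L ; r = r L ; b = λ j → if X j then nothing else b L j ; g = g L
  ; domEq = domEq L ; fin = fin L }

data GenId {A B : Set} {ℓ : Set} (f₁ : ℓ → Maybe A) (f₂ : ℓ → Maybe B) :
     A ⊎ B → A ⊎ B → Set where
  gen : ∀ j a c → f₁ j ≡ just a → f₂ j ≡ just c → GenId f₁ f₂ (inj₁ a) (inj₂ c)

-- IsGlue L₁ L₂ L : L is (a copy of) the glueing L₁ · L₂, i.e. its skeleton is
-- the quotient of the disjoint union of the skeletons by the equivalence
-- relation generated by identifying equally labeled vertices (ι maps are the
-- quotient maps), edges are the images of the edges, and labels are induced.
record IsGlue {k} (L₁ L₂ L : LIG k) : Set where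
  field
    ιR₁ : Fin (nR (G L₁)) → Fin (nR (G L))
    ιR₂ : Fin (nR (G L₂)) → Fin (nR (G L))
    ιB₁ : Fin (nB (G L₁)) → Fin (nB (G L))
    ιB₂ : Fin (nB (G L₂)) → Fin (nB (G L))
    surjR : ∀ v → (∃[ x ] (ιR₁ x ≡ v)) ⊎ (∃[ y ] (ιR₂ y ≡ v))
    surjB : ∀ e → (∃[ x ] (ιB₁ x ≡ e)) ⊎ (∃[ y ] (ιB₂ y ≡ e))
    kerR : ∀ x y → ([ ιR₁ , ιR₂ ]′ x ≡ [ ιR₁ , ιR₂ ]′ y)
                   ⇔ EqClosure (GenId (r L₁) (r L₂)) x y
    kerB : ∀ x y → ([ ιB₁ , ιB₂ ]′ x ≡ [ ιB₁ , ιB₂ ]′ y)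
                   ⇔ EqClosure (GenId (b L₁) (b L₂)) x y
    edges : ∀ e v → (E (G L) e v ≡ true) ⇔
              ((∃[ x ] ∃[ y ] (E (G L₁) x y ≡ true × ιB₁ x ≡ e × ιR₁ y ≡ v))
               ⊎ (∃[ x ] ∃[ y ] (E (G L₂) x y ≡ true × ιB₂ x ≡ e × ιR₂ y ≡ v)))
    labR : ∀ i → r L i ≡ (Maybe.map ιR₁ (r L₁ i) <∣> Maybe.map ιR₂ (r L₂ i))
    labB : ∀ j → b L j ≡ (Maybe.map ιB₁ (b L₁ j) <∣> Maybe.map ιB₂ (b L₂ j))
    labG : ∀ i → g L i ≡ (g L₁ i <∣> g L₂ i)

record IsTransition {k} (L : LIG k) (f : ℕ → Maybe (Fin k)) : Set where
  field
    nonempty : ∃[ i ] (InDom f i)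
    domSub   : ∀ i → InDom f i → InDom (g L) i
    closed   : ∀ i j → g L i ≡ just j → InImg f j → InDom f i

-- IsM f M : M is (a copy of) M_f: red vertices v_i (i ∈ dom f), blue vertices
-- e_j (j ∈ img f), edges (e_{f(i)}, v_i), r(i) = v_i, b(j) = e_j, g = f.
record IsM {k} (f : ℕ → Maybe (Fin k)) (M : LIG k) : Set where
  field
    rDom  : ∀ i → is-just (r M i) ≡ is-just (f i)
    rInj  : ∀ i i' v → r M i ≡ just v → r M i' ≡ just v → i ≡ i'
    rSurj : ∀ v → ∃[ i ] (r M i ≡ just v)
    bDom  : ∀ j → InDom (b M) j ⇔ InImg f j
    bInj  : ∀ j j' e → b M j ≡ just e → b M j' ≡ just e → j ≡ j'
    bSurj : ∀ e → ∃[ j ] (b M j ≡ just e)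
    gEq   : ∀ i → g M i ≡ f i
    edges : ∀ e v → (E (G M) e v ≡ true) ⇔
              (∃[ i ] ∃[ j ] (r M i ≡ just v × b M j ≡ just e × f i ≡ just j))

data GLI (k : ℕ) : ℕ → LIG k → Set where
  base : ∀ L → RealGuards L →
         (∀ v → ∃[ i ] (r L i ≡ just v)) → (∀ e → ∃[ j ] (b L j ≡ just e)) →
         GLI k 0 L
  lift : ∀ {i L} → GLI k i L → GLI k (suc i) L
  glue : ∀ {i₁ i₂ L₁ L₂} → GLI k i₁ L₁ → GLI k i₂ L₂ →
         Compatible (g L₁) (g L₂) → ∀ L → IsGlue L₁ L₂ L → GLI k (i₁ ⊔ i₂) L
  trans : ∀ {i L} → GLI k i L → ∀ f → IsTransition L f →
          ∀ (S : Fin k → Bool) →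
          (∀ j → (S j ≡ true) ⇔ (InImg f j × InDom (b L) j × InImg (g L) j)) →
          ∀ M → IsM f M → ∀ L' → IsGlue M (removeBlue L S) L' →
          GLI k (i + card S) L'
  redRem : ∀ {i L} → GLI k i L → ∀ (X : ℕ → Bool) →
           (∀ j → X j ≡ true → InDom (r L) j) → GLI k i (removeRed L X)
  blueRem : ∀ {i L} → GLI k i L → ∀ (X : Fin k → Bool) →
            (∀ j → X j ≡ true → InDom (b L) j × ¬ InImg (g L) j) →
            GLI k (i + card X) (removeBlue L X)

GLI^ : (k : ℕ) → LIG k → Set
GLI^ k L = GLI k k L

-- Soundness.  By induction on a derivation of L ∈ GLI_k^i (with real guards), the blue
-- vertices of L carry a forest in which labelled blue vertices are roots, unlabelled ones have
-- depth ≤ i, and a red vertex shared by two unlabelled blue vertices lies in a common ancestor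
-- of both or in a labelled blue vertex.  Glueing never identifies unlabelled blue vertices, so
-- the forests of the two parts just sit side by side; a red vertex shared by the two parts
-- carries a red label, and its guard is a labelled blue vertex containing it.  Removing c blue
-- labels stacks the c vertices that lost their label as a path above all old roots, which costs
-- c levels.  When L is label-free this is a strict elimination forest of height ≤ k.
--
-- Completeness.  Strictness puts all nodes containing a red vertex v below a single topmost
-- one, whose depth serves as the guard of v.  For a node t of depth d, the subtree of t
-- together with the path P(t) above it is built in GLI_k^(k-d): the node of P(t) at depth e
-- carries blue label e, and a red vertex keeps its label exactly when it also meets P(t).  The
-- subtrees of the children of t are glued one at a time (by strictness, a red vertex they
-- share meets P(t)), and closing the subtree of a child removes the red labels that no longer
-- meet the path together with the blue label of the child, which costs one level.

module Submission where

open import Defs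
open import Data.Nat using (ℕ; zero; suc; _+_; _≤_; _<_; _≥_; _⊔_; _∸_; z≤n; s≤s; s≤s⁻¹)
open import Data.Nat.Properties
open import Data.Fin using (Fin; zero; suc; toℕ; fromℕ; fromℕ<; inject₁)
import Data.Fin.Properties as FinP
open import Data.Bool using (Bool; true; false; if_then_else_; _∧_; _∨_; not)
open import Data.Bool.Properties using (∧-distribʳ-∨)
import Data.Bool.Properties as BoolP
open import Data.Maybe using (Maybe; just; nothing; is-just; _<∣>_)
import Data.Maybe as Maybe
open import Data.Maybe.Properties using (just-injective)
import Data.Maybe.Properties as MaybeP
open import Data.Product using (∃; ∃-syntax; _×_; _,_; proj₁; proj₂)
open import Data.Sum using (_⊎_; inj₁; inj₂; [_,_]′)
open import Data.Empty using (⊥; ⊥-elim)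
open import Relation.Binary.Definitions using (Reflexive; Transitive; Total)
open import Relation.Binary.PropositionalEquality renaming (trans to ≡tr)
open import Relation.Nullary using (¬_; Dec; yes; no; does; ¬?; _×-dec_)
open import Relation.Nullary.Decidable using (dec-true; dec-false)
open import Function.Bundles using (_⇔_; _⤖_; Bijection; mk⇔; mk⤖; Equivalence)
open import Function.Base using (_∘_)
open import Function.Construct.Identity using (⤖-id)
open import Function.Construct.Composition using (_⤖-∘_)
open import Induction.WellFounded using (WellFounded; Acc; acc)
open import Relation.Binary.Construct.Closure.Equivalence using (EqClosure)
open import Relation.Binary.Construct.Closure.Symmetric using (fwd; bwd)
open import Relation.Binary.Construct.Closure.ReflexiveTransitive using (Star; ε; _◅_)

true≢false : true ≢ false
true≢false ()

just≢nothing : ∀ {A : Set} {x : A} → just x ≢ nothing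
just≢nothing ()

dec-true⁻¹ : ∀ {P : Set} (d : Dec P) → does d ≡ true → P
dec-true⁻¹ (yes p) _ = p

dec-false⁻¹ : ∀ {P : Set} (d : Dec P) → does d ≡ false → ¬ P
dec-false⁻¹ (no ¬p) _ = ¬p

∨≡true⇒⊎ : ∀ x y → x ∨ y ≡ true → x ≡ true ⊎ y ≡ true
∨≡true⇒⊎ true  y _ = inj₁ refl
∨≡true⇒⊎ false y p = inj₂ p

∨-introˡ : ∀ x y → x ≡ true → x ∨ y ≡ true
∨-introˡ true y _ = refl

∨-introʳ : ∀ x y → y ≡ true → x ∨ y ≡ true
∨-introʳ true  y _ = refl
∨-introʳ false y p = p

∧≡true⇒× : ∀ x y → x ∧ y ≡ true → x ≡ true × y ≡ true
∧≡true⇒× true true _ = refl , refl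

∧-intro : ∀ {x y} → x ≡ true → y ≡ true → x ∧ y ≡ true
∧-intro refl refl = refl

not≡true⇒≡false : ∀ x → not x ≡ true → x ≡ false
not≡true⇒≡false false _ = refl

not≡false⇒≡true : ∀ x → not x ≡ false → x ≡ true
not≡false⇒≡true true _ = refl

∨-distribˡ-∨ : ∀ p a c → (p ∨ (a ∨ c)) ≡ ((p ∨ a) ∨ (p ∨ c))
∨-distribˡ-∨ true  a c = refl
∨-distribˡ-∨ false a c = refl

bool-ext : ∀ x y → (x ≡ true → y ≡ true) → (y ≡ true → x ≡ true) → x ≡ y
bool-ext true  y     f _ = sym (f refl)
bool-ext false true  _ g = g refl
bool-ext false false _ _ = refl

Star-firstStep : ∀ {A : Set} {R : A → A → Set} {x y} → Star R x y → x ≡ y ⊎ ∃ (R x)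
Star-firstStep ε       = inj₁ refl
Star-firstStep (r ◅ _) = inj₂ (_ , r)

map≡just⇒ : ∀ {A B : Set} (h : A → B) {m : Maybe A} {y} →
            Maybe.map h m ≡ just y → ∃[ x ] (m ≡ just x × h x ≡ y)
map≡just⇒ h {just x} refl = x , refl , refl

map≡nothing⇒ : ∀ {A B : Set} (h : A → B) {m : Maybe A} → Maybe.map h m ≡ nothing → m ≡ nothing
map≡nothing⇒ h {nothing} _ = refl

is-just≡⇒nothing : ∀ {A B : Set} {m : Maybe A} {m' : Maybe B} →
                   is-just m ≡ is-just m' → m ≡ nothing → m' ≡ nothing
is-just≡⇒nothing {m' = nothing} _  _    = refl
is-just≡⇒nothing {m = nothing} {just _} () refl

is-just≡⇒just : ∀ {A B : Set} {m : Maybe A} {m' : Maybe B} {x} →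
                is-just m ≡ is-just m' → m ≡ just x → ∃[ y ] (m' ≡ just y)
is-just≡⇒just {m' = just y}  _  _    = y , refl
is-just≡⇒just {m' = nothing} () refl

_≟ᴹ_ : ∀ {n} (x y : Maybe (Fin n)) → Dec (x ≡ y)
_≟ᴹ_ = MaybeP.≡-dec FinP._≟_

is-just-map : ∀ {A B : Set} (h : A → B) (m : Maybe A) → is-just m ≡ is-just (Maybe.map h m)
is-just-map h nothing  = refl
is-just-map h (just _) = refl

-- Searching finite sets

module Enumeration where
  private
    enumStep : ∀ {m n} (β : Bool) → (Fin m → Fin n) → Fin ((if β then 1 else 0) + m) → Fin (suc n)
    enumStep true  f zero    = zero
    enumStep true  f (suc y) = suc (f y)
    enumStep false f y       = suc (f y)

    indexHead : ∀ {m} (β : Bool) → β ≡ true → Fin ((if β then 1 else 0) + m)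
    indexHead true _ = zero

    indexTail : ∀ {m} (β : Bool) → Fin m → Fin ((if β then 1 else 0) + m)
    indexTail true  y = suc y
    indexTail false y = y

    enumStep-indexHead : ∀ {m n} β p (f : Fin m → Fin n) → enumStep β f (indexHead β p) ≡ zero
    enumStep-indexHead true p f = refl

    enumStep-indexTail : ∀ {m n} β y (f : Fin m → Fin n) → enumStep β f (indexTail β y) ≡ suc (f y)
    enumStep-indexTail true  y f = refl
    enumStep-indexTail false y f = refl

    enumStep-P : ∀ {m n} (P : Fin (suc n) → Bool) (f : Fin m → Fin n) β → P zero ≡ β →
                 (∀ y → P (suc (f y)) ≡ true) → ∀ y → P (enumStep β f y) ≡ true
    enumStep-P P f true  eq h zero    = eq
    enumStep-P P f true  eq h (suc y) = h y
    enumStep-P P f false eq h y       = h y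

    enumStep-injective : ∀ {m n} β (f : Fin m → Fin n) → (∀ {y y'} → f y ≡ f y' → y ≡ y') →
                         ∀ {y y'} → enumStep β f y ≡ enumStep β f y' → y ≡ y'
    enumStep-injective true  f fi {zero}  {zero}   eq = refl
    enumStep-injective true  f fi {suc y} {suc y'} eq = cong suc (fi (FinP.suc-injective eq))
    enumStep-injective false f fi eq = fi (FinP.suc-injective eq)

  enum : ∀ {n} (P : Fin n → Bool) → Fin (card P) → Fin n
  enum {suc n} P = enumStep (P zero) (enum (λ j → P (suc j)))

  index : ∀ {n} (P : Fin n → Bool) (x : Fin n) → P x ≡ true → Fin (card P)
  index {suc n} P zero    p = indexHead (P zero) p
  index {suc n} P (suc x) p = indexTail (P zero) (index (λ j → P (suc j)) x p)

  enum-index : ∀ {n} (P : Fin n → Bool) x p → enum P (index P x p) ≡ x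
  enum-index {suc n} P zero    p = enumStep-indexHead (P zero) p _
  enum-index {suc n} P (suc x) p =
    ≡tr (enumStep-indexTail (P zero) _ _) (cong suc (enum-index (λ j → P (suc j)) x p))

  enum-P : ∀ {n} (P : Fin n → Bool) y → P (enum P y) ≡ true
  enum-P {suc n} P y = enumStep-P P _ (P zero) refl (enum-P (λ j → P (suc j))) y

  enum-injective : ∀ {n} (P : Fin n → Bool) {y y'} → enum P y ≡ enum P y' → y ≡ y'
  enum-injective {suc n} P = enumStep-injective (P zero) _ (enum-injective (λ j → P (suc j)))

  index-enum : ∀ {n} (P : Fin n → Bool) y p → index P (enum P y) p ≡ y
  index-enum P y p = enum-injective P (enum-index P (enum P y) p)

open Enumeration public

card-false : ∀ {n} (P : Fin n → Bool) → (∀ j → P j ≡ false) → card P ≡ 0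
card-false {zero}  P h = refl
card-false {suc n} P h = cong₂ (λ β m → (if β then 1 else 0) + m) (h zero) (card-false _ (h ∘ suc))

card-singleton : ∀ {n} (j₀ : Fin n) → card (λ j → does (j FinP.≟ j₀)) ≡ 1
card-singleton {suc n} zero = cong suc (card-false {n} (λ j → does (suc j FinP.≟ zero)) (λ j → refl))
card-singleton (suc j₀)     = card-singleton j₀

first : ∀ {n} → (Fin n → Bool) → Maybe (Fin n)
first {zero}  P = nothing
first {suc n} P = if P zero then just zero else Maybe.map suc (first (λ j → P (suc j)))

first-sound : ∀ {n} (P : Fin n → Bool) {a} → first P ≡ just a → P a ≡ true
first-sound {suc n} P {a} eq with P zero in pz
first-sound {suc n} P {zero} refl | true = pz
first-sound {suc n} P {a} eq | false with first (λ j → P (suc j)) in fe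
first-sound {suc n} P {suc a} refl | false | just a = first-sound (λ j → P (suc j)) fe

first-complete : ∀ {n} (P : Fin n → Bool) a → P a ≡ true → ∃[ a' ] (first P ≡ just a')
first-complete {suc n} P a pa with P zero in pz
... | true = zero , refl
first-complete {suc n} P zero    pa | false = ⊥-elim (true≢false (≡tr (sym pa) pz))
first-complete {suc n} P (suc a) pa | false with first-complete (λ j → P (suc j)) a pa
... | a' , eq rewrite eq = suc a' , refl

first-ext : ∀ {n} (P Q : Fin n → Bool) → (∀ x → P x ≡ Q x) → first P ≡ first Q
first-ext {zero}  P Q h = refl
first-ext {suc n} P Q h rewrite h zero
  | first-ext (λ j → P (suc j)) (λ j → Q (suc j)) (λ x → h (suc x)) = refl

anyB : ∀ {n} → (Fin n → Bool) → Bool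
anyB P = is-just (first P)

anyB-intro : ∀ {n} (P : Fin n → Bool) a → P a ≡ true → anyB P ≡ true
anyB-intro P a pa with first-complete P a pa
... | a' , eq rewrite eq = refl

anyB-elim : ∀ {n} (P : Fin n → Bool) → anyB P ≡ true → ∃[ a ] (P a ≡ true)
anyB-elim P h with first P in eq
... | just a = a , first-sound P eq

anyB-ext : ∀ {n} (P Q : Fin n → Bool) → (∀ x → P x ≡ Q x) → anyB P ≡ anyB Q
anyB-ext P Q h = cong is-just (first-ext P Q h)

optimum : ∀ {n} {_≼_ : ℕ → ℕ → Set} → Reflexive _≼_ → Transitive _≼_ → Total _≼_ →
          (Q : Fin n → Bool) (f : Fin n → ℕ) → ∀ a → Q a ≡ true →
          ∃[ x ] (Q x ≡ true × (∀ y → Q y ≡ true → f x ≼ f y))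
optimum {suc n} {_≼_} ≼-refl ≼-trans ≼-total Q f a qa
  with Q zero in q0 | FinP.any? (λ j → Q (suc j) BoolP.≟ true)
... | false | no none with a
...   | zero  = ⊥-elim (true≢false (≡tr (sym qa) q0))
...   | suc a' = ⊥-elim (none (a' , qa))
optimum ≼-refl ≼-trans ≼-total Q f a qa | true | no none =
  zero , q0 , λ { zero _ → ≼-refl ; (suc y) qy → ⊥-elim (none (y , qy)) }
optimum ≼-refl ≼-trans ≼-total Q f a qa | q | yes (a' , qa')
  with optimum ≼-refl ≼-trans ≼-total (λ j → Q (suc j)) (λ j → f (suc j)) a' qa'
... | x , qx , best with q
...   | false = suc x , qx , λ { zero qy → ⊥-elim (true≢false (≡tr (sym qy) q0)) ; (suc y) qy → best y qy }
...   | true with ≼-total (f zero) (f (suc x))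
...     | inj₁ le = zero , q0 , λ { zero _ → ≼-refl ; (suc y) qy → ≼-trans le (best y qy) }
...     | inj₂ ge = suc x , qx , λ { zero _ → ge ; (suc y) qy → best y qy }

argmin : ∀ {n} (Q : Fin n → Bool) (f : Fin n → ℕ) a → Q a ≡ true →
         ∃[ x ] (Q x ≡ true × (∀ y → Q y ≡ true → f x ≤ f y))
argmin = optimum ≤-refl ≤-trans ≤-total

argmax : ∀ {n} (Q : Fin n → Bool) (f : Fin n → ℕ) a → Q a ≡ true →
         ∃[ x ] (Q x ≡ true × (∀ y → Q y ≡ true → f y ≤ f x))
argmax = optimum {_≼_ = _≥_} ≤-refl (λ p q → ≤-trans q p) (λ x y → ≤-total y x)

finPred : ∀ {c} → Fin c → Maybe (Fin c)
finPred zero = nothing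
finPred (suc y) = just (inject₁ y)

finPred-nothing : ∀ {c} (y : Fin c) → finPred y ≡ nothing → toℕ y ≡ 0
finPred-nothing zero _ = refl

finPred-just : ∀ {c} (y : Fin c) {y'} → finPred y ≡ just y' → toℕ y ≡ suc (toℕ y')
finPred-just (suc y) refl = cong suc (sym (FinP.toℕ-inject₁ y))

finPred-suc : ∀ {c} (y : Fin c) m → toℕ y ≡ suc m → ∃[ y' ] (finPred y ≡ just y' × toℕ y' ≡ m)
finPred-suc (suc y) m eq = inject₁ y , refl , ≡tr (FinP.toℕ-inject₁ y) (suc-injective eq)

finLast : ∀ c → Maybe (Fin c)
finLast zero = nothing
finLast (suc c) = just (fromℕ c)

finLast-nothing : ∀ c → finLast c ≡ nothing → c ≡ 0
finLast-nothing zero _ = refl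

finLast-just : ∀ c {y} → finLast c ≡ just y → suc (toℕ y) ≡ c
finLast-just (suc c) refl = cong suc (FinP.toℕ-fromℕ c)

finLast-above : ∀ {c} (y : Fin c) → ∃[ yl ] (finLast c ≡ just yl × toℕ y ≤ toℕ yl)
finLast-above {suc c} y = fromℕ c , refl ,
                     subst (toℕ y ≤_) (sym (FinP.toℕ-fromℕ c)) (FinP.toℕ≤pred[n] y)

-- Forests

Anc-trans : ∀ {n} {F : Forest n} {a b c} → Anc F a b → Anc F b c → Anc F a c
Anc-trans ab here         = ab
Anc-trans ab (there e bc) = there e (Anc-trans ab bc)

Anc-comparable : ∀ {n} {F : Forest n} {a b s} → Anc F a s → Anc F b s → Anc F a b ⊎ Anc F b a
Anc-comparable here         bs            = inj₂ bs
Anc-comparable (there e as) here          = inj₁ (there e as)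
Anc-comparable (there e as) (there e' bs) with just-injective (≡tr (sym e) e')
... | refl = Anc-comparable as bs

record Depth {n : ℕ} (F : Forest n) : Set where
  field
    dep : Fin n → ℕ
    depRoot : ∀ s → parent F s ≡ nothing → dep s ≡ 1
    depStep : ∀ s p → parent F s ≡ just p → dep s ≡ suc (dep p)

depth⇒wellFounded : ∀ {n} (par : Fin n → Maybe (Fin n)) (dep : Fin n → ℕ) →
                    (∀ s p → par s ≡ just p → dep s ≡ suc (dep p)) →
                    WellFounded (λ p s → par s ≡ just p)
depth⇒wellFounded par dep dstep s = go (suc (dep s)) s ≤-refl
  where
  go : ∀ m s → dep s < m → Acc (λ p s → par s ≡ just p) s
  go (suc m) s lt = acc λ {y} eq → go m y (subst (_≤ m) (dstep s y eq) (s≤s⁻¹ lt))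

mkForest : ∀ {n} (par : Fin n → Maybe (Fin n)) (dep : Fin n → ℕ) →
           (∀ s p → par s ≡ just p → dep s ≡ suc (dep p)) → Forest n
mkForest par dep dstep = record { parent = par ; wf = depth⇒wellFounded par dep dstep }

pathLen-exists : ∀ {n} (F : Forest n) s → Acc (λ p s → parent F s ≡ just p) s → ∃[ m ] (PathLen F s m)
pathLen-exists F s (acc rs) with parent F s in eq
... | nothing = 1 , root eq
... | just p with pathLen-exists F p (rs refl)
... | m , pl = suc m , step eq pl

PathLen-unique : ∀ {n} {F : Forest n} {s m m'} → PathLen F s m → PathLen F s m' → m ≡ m'
PathLen-unique (root e)    (root e')    = refl
PathLen-unique (root e)    (step e' _)  = ⊥-elim (just≢nothing (≡tr (sym e') e))
PathLen-unique (step e _)  (root e')    = ⊥-elim (just≢nothing (≡tr (sym e) e'))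
PathLen-unique (step e pl) (step e' pl') with just-injective (≡tr (sym e) e')
... | refl = cong suc (PathLen-unique pl pl')

depthOf : ∀ {n} (F : Forest n) → Depth F
depthOf {n} F = record { dep = dp ; depRoot = dr ; depStep = ds }
  where
  dp : Fin n → ℕ
  dp s = proj₁ (pathLen-exists F s (wf F s))
  pl : ∀ s → PathLen F s (dp s)
  pl s = proj₂ (pathLen-exists F s (wf F s))
  dr : ∀ s → parent F s ≡ nothing → dp s ≡ 1
  dr s e = PathLen-unique (pl s) (root e)
  ds : ∀ s p → parent F s ≡ just p → dp s ≡ suc (dp p)
  ds s p e = PathLen-unique (pl s) (step e (pl p))

module Ancestry {n : ℕ} (F : Forest n) (D : Depth F) where
  open Depth D

  dep≥1 : ∀ s → 1 ≤ dep s
  dep≥1 s with parent F s in e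
  ... | nothing = ≤-reflexive (sym (depRoot s e))
  ... | just p  = subst (1 ≤_) (sym (depStep s p e)) (s≤s z≤n)

  Anc⇒dep≤ : ∀ {p s} → Anc F p s → dep p ≤ dep s
  Anc⇒dep≤ here = ≤-refl
  Anc⇒dep≤ (there {q = q} e a) = ≤-trans (Anc⇒dep≤ a) (subst (dep q ≤_) (sym (depStep _ _ e)) (n≤1+n _))

  Anc⇒dep< : ∀ {p s} → Anc F p s → p ≢ s → dep p < dep s
  Anc⇒dep< here        ne = ⊥-elim (ne refl)
  Anc⇒dep< (there e a) _  = ≤-trans (s≤s (Anc⇒dep≤ a)) (≤-reflexive (sym (depStep _ _ e)))

  Anc-dep≡⇒≡ : ∀ {p s} → Anc F p s → dep p ≡ dep s → p ≡ s
  Anc-dep≡⇒≡ here _ = refl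
  Anc-dep≡⇒≡ {p} {s} a@(there _ _) eq with p FinP.≟ s
  ... | yes ps = ps
  ... | no ne  = ⊥-elim (<-irrefl eq (Anc⇒dep< a ne))

  Anc-sameDepth⇒≡ : ∀ {a b q} → Anc F a q → Anc F b q → dep a ≡ dep b → a ≡ b
  Anc-sameDepth⇒≡ aq bq eq with Anc-comparable aq bq
  ... | inj₁ ab = Anc-dep≡⇒≡ ab eq
  ... | inj₂ ba = sym (Anc-dep≡⇒≡ ba (sym eq))

  private
    Anc?-bounded : ∀ m p s → dep s ≤ m → Dec (Anc F p s)
    Anc?-bounded zero p s le = ⊥-elim (<-irrefl refl (≤-trans (dep≥1 s) le))
    Anc?-bounded (suc m) p s le with p FinP.≟ s
    ... | yes refl = yes here
    ... | no ne with parent F s in eq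
    ...   | nothing = no λ { here → ne refl ; (there e _) → just≢nothing (≡tr (sym e) eq) }
    ...   | just q with Anc?-bounded m p q (s≤s⁻¹ (subst (_≤ suc m) (depStep s q eq) le))
    ...     | yes a = yes (there eq a)
    ...     | no na = no λ { here → ne refl
                           ; (there e a) → na (subst (Anc F p) (just-injective (≡tr (sym e) eq)) a) }

    rootAbove-bounded : ∀ m s → dep s ≤ m → ∃[ ρ ] (parent F ρ ≡ nothing × Anc F ρ s)
    rootAbove-bounded zero s le = ⊥-elim (<-irrefl refl (≤-trans (dep≥1 s) le))
    rootAbove-bounded (suc m) s le with parent F s in eq
    ... | nothing = s , eq , here
    ... | just q with rootAbove-bounded m q (s≤s⁻¹ (subst (_≤ suc m) (depStep s q eq) le))
    ...   | ρ , eρ , a = ρ , eρ , there eq a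

  Anc? : ∀ p s → Dec (Anc F p s)
  Anc? p s = Anc?-bounded (dep s) p s ≤-refl

  ancᵇ : Fin n → Fin n → Bool
  ancᵇ p s = does (Anc? p s)

  rootAbove : ∀ s → ∃[ ρ ] (parent F ρ ≡ nothing × Anc F ρ s)
  rootAbove s = rootAbove-bounded (dep s) s ≤-refl

  PathLen⇒≡dep : ∀ {s m} → PathLen F s m → m ≡ dep s
  PathLen⇒≡dep (root e)    = sym (depRoot _ e)
  PathLen⇒≡dep (step e pl) = ≡tr (cong suc (PathLen⇒≡dep pl)) (sym (depStep _ _ e))

  PathLen-dep : ∀ s → PathLen F s (dep s)
  PathLen-dep s = subst (PathLen F s) (PathLen⇒≡dep pl) pl
    where
    pl : PathLen F s (proj₁ (pathLen-exists F s (wf F s)))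
    pl = proj₂ (pathLen-exists F s (wf F s))

  lcv-exists : ∀ {p s t} → Anc F p s → Anc F p t → ∃[ c ] (IsLcv F s t c)
  lcv-exists {p} {s} {t} ps pt with argmax (λ x → ancᵇ x s ∧ ancᵇ x t) dep p
                                      (∧-intro (dec-true (Anc? p s) ps) (dec-true (Anc? p t) pt))
  ... | c , qc , deepest with ∧≡true⇒× _ _ qc
  ... | cs , ct = c , dec-true⁻¹ (Anc? c s) cs , dec-true⁻¹ (Anc? c t) ct , below
    where
    below : ∀ d → Anc F d s → Anc F d t → Anc F d c
    below d ds dt with Anc-comparable ds (dec-true⁻¹ (Anc? c s) cs)
    ... | inj₁ dc = dc
    ... | inj₂ cd = subst (λ z → Anc F z c)
            (Anc-dep≡⇒≡ cd (≤-antisym (Anc⇒dep≤ cd)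
               (deepest d (∧-intro (dec-true (Anc? d s) ds) (dec-true (Anc? d t) dt))))) here

GLI-mono : ∀ {k i j L} → GLI k i L → i ≤ j → GLI k j L
GLI-mono {j = zero} d z≤n = d
GLI-mono {j = suc j} d le with m≤n⇒m<n∨m≡n le
... | inj₂ refl = d
... | inj₁ lt = lift (GLI-mono d (s≤s⁻¹ lt))

module Soundness {k : ℕ} where

  Labelled : (L : LIG k) → Fin (nB (G L)) → Set
  Labelled L e = ∃[ j ] (b L j ≡ just e)

  Labelled? : (L : LIG k) → ∀ e → Dec (Labelled L e)
  Labelled? L e = FinP.any? (λ j → _≟ᴹ_ (b L j) (just e))

  WeakGuards : LIG k → Set
  WeakGuards L = ∀ i v → r L i ≡ just v → ∃[ e ] (Labelled L e × E (G L) e v ≡ true)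

  RealGuards⇒WeakGuards : ∀ {L : LIG k} → RealGuards L → WeakGuards L
  RealGuards⇒WeakGuards rg i v rv with rg i v rv
  ... | j , _ , e , bj , ev = e , (j , bj) , ev

  SharedRedCovered : (L : LIG k) → Forest (nB (G L)) → (s t : Fin (nB (G L))) → Fin (nR (G L)) → Set
  SharedRedCovered L F s t v =
    (∃[ p ] (Anc F p s × Anc F p t × E (G L) p v ≡ true)) ⊎ (∃[ e ] (Labelled L e × E (G L) e v ≡ true))

  record LabelledElimForest (i : ℕ) (L : LIG k) : Set where
    field
      par : Fin (nB (G L)) → Maybe (Fin (nB (G L)))
      dep : Fin (nB (G L)) → ℕ
      depRoot : ∀ s → par s ≡ nothing → dep s ≡ 1
      depStep : ∀ s p → par s ≡ just p → dep s ≡ suc (dep p)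
      labRoot : ∀ e → Labelled L e → par e ≡ nothing
      parUnlab : ∀ s p → par s ≡ just p → ¬ Labelled L p
      height : ∀ s → ¬ Labelled L s → dep s ≤ i
      strict : ∀ s t v → ¬ Labelled L s → ¬ Labelled L t → E (G L) s v ≡ true → E (G L) t v ≡ true →
               SharedRedCovered L (mkForest par dep depStep) s t v
    forest : Forest (nB (G L))
    forest = mkForest par dep depStep
    depth : Depth forest
    depth = record { dep = dep ; depRoot = depRoot ; depStep = depStep }

  allLabelled-forest : ∀ {L} → (∀ e → Labelled L e) → LabelledElimForest 0 L
  allLabelled-forest {L} all = record
    { par = λ _ → nothing ; dep = λ _ → 1 ; depRoot = λ _ _ → refl ; depStep = λ _ _ ()
    ; labRoot = λ _ _ → refl ; parUnlab = λ _ _ () ; height = λ s nl → ⊥-elim (nl (all s))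
    ; strict = λ s t v nl _ _ _ → ⊥-elim (nl (all s)) }

  LabelledElimForest-lift : ∀ {i L} → LabelledElimForest i L → LabelledElimForest (suc i) L
  LabelledElimForest-lift FI = record
    { par = par ; dep = dep ; depRoot = depRoot ; depStep = depStep ; labRoot = labRoot
    ; parUnlab = parUnlab ; height = λ s nl → m≤n⇒m≤1+n (height s nl) ; strict = strict }
    where open LabelledElimForest FI


  module GlueFacts {L₁ L₂ L : LIG k} (gl : IsGlue L₁ L₂ L) where
    open IsGlue gl public

    Blue₁₂ : Set
    Blue₁₂ = Fin (nB (G L₁)) ⊎ Fin (nB (G L₂))
    Red₁₂ : Set
    Red₁₂ = Fin (nR (G L₁)) ⊎ Fin (nR (G L₂))

    ιB : Blue₁₂ → Fin (nB (G L))
    ιB = [ ιB₁ , ιB₂ ]′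

    ιR : Red₁₂ → Fin (nR (G L))
    ιR = [ ιR₁ , ιR₂ ]′

    Labelled₁₂ : Blue₁₂ → Set
    Labelled₁₂ (inj₁ a) = Labelled L₁ a
    Labelled₁₂ (inj₂ c) = Labelled L₂ c

    RedLabelled₁₂ : Red₁₂ → Set
    RedLabelled₁₂ (inj₁ y) = ∃[ j ] (r L₁ j ≡ just y)
    RedLabelled₁₂ (inj₂ y) = ∃[ j ] (r L₂ j ≡ just y)

    ιB-injective-unlabelled : ∀ z z' → ¬ Labelled₁₂ z → ιB z ≡ ιB z' → z ≡ z'
    ιB-injective-unlabelled z z' nl eq with Star-firstStep (Equivalence.to (kerB z z') eq)
    ... | inj₁ e = e
    ... | inj₂ (w , fwd (gen j a c ba bc)) = ⊥-elim (nl (j , ba))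
    ... | inj₂ (w , bwd (gen j a c ba bc)) = ⊥-elim (nl (j , bc))

    ιR-identified⇒labelled : ∀ w w' → ιR w ≡ ιR w' → w ≡ w' ⊎ RedLabelled₁₂ w
    ιR-identified⇒labelled w w' eq with Star-firstStep (Equivalence.to (kerR w w') eq)
    ... | inj₁ e = inj₁ e
    ... | inj₂ (_ , fwd (gen j a c ra rc)) = inj₂ (j , ra)
    ... | inj₂ (_ , bwd (gen j a c ra rc)) = inj₂ (j , rc)

    bL₂ : ∀ j c → b L₂ j ≡ just c → b L j ≡ just (ιB₂ c)
    bL₂ j c bc with b L₁ j in ba
    ... | nothing = ≡tr (labB j) (cong₂ (λ m1 m2 → Maybe.map ιB₁ m1 <∣> Maybe.map ιB₂ m2) ba bc)
    ... | just a = ≡tr (labB j) (≡tr (cong₂ (λ m1 m2 → Maybe.map ιB₁ m1 <∣> Maybe.map ιB₂ m2) ba bc)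
                    (cong just (Equivalence.from (kerB (inj₁ a) (inj₂ c)) (fwd (gen j a c ba bc) ◅ ε))))

    bL₁ : ∀ j a → b L₁ j ≡ just a → b L j ≡ just (ιB₁ a)
    bL₁ j a ba = ≡tr (labB j) (cong (λ m1 → Maybe.map ιB₁ m1 <∣> Maybe.map ιB₂ (b L₂ j)) ba)

    rL₂ : ∀ j c → r L₂ j ≡ just c → r L j ≡ just (ιR₂ c)
    rL₂ j c rc with r L₁ j in ra
    ... | nothing = ≡tr (labR j) (cong₂ (λ m1 m2 → Maybe.map ιR₁ m1 <∣> Maybe.map ιR₂ m2) ra rc)
    ... | just a = ≡tr (labR j) (≡tr (cong₂ (λ m1 m2 → Maybe.map ιR₁ m1 <∣> Maybe.map ιR₂ m2) ra rc)
                    (cong just (Equivalence.from (kerR (inj₁ a) (inj₂ c)) (fwd (gen j a c ra rc) ◅ ε))))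

    rL₁ : ∀ j a → r L₁ j ≡ just a → r L j ≡ just (ιR₁ a)
    rL₁ j a ra = ≡tr (labR j) (cong (λ m1 → Maybe.map ιR₁ m1 <∣> Maybe.map ιR₂ (r L₂ j)) ra)

    ιB-Labelled : ∀ z → Labelled₁₂ z → Labelled L (ιB z)
    ιB-Labelled (inj₁ a) (j , ba) = j , bL₁ j a ba
    ιB-Labelled (inj₂ c) (j , bc) = j , bL₂ j c bc

    ιR-labelled : ∀ w → RedLabelled₁₂ w → ∃[ j ] (r L j ≡ just (ιR w))
    ιR-labelled (inj₁ a) (j , ra) = j , rL₁ j a ra
    ιR-labelled (inj₂ c) (j , rc) = j , rL₂ j c rc

    ιB-unlabelled : ∀ z → ¬ Labelled₁₂ z → ¬ Labelled L (ιB z)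
    ιB-unlabelled z nl (j , bj) with b L₁ j in ba | b L₂ j in bc
    ... | just a | _ = nl (subst Labelled₁₂ (sym (ιB-injective-unlabelled z (inj₁ a) nl
                          (sym (just-injective (≡tr (sym (bL₁ j a ba)) bj))))) (j , ba))
    ... | nothing | just c = nl (subst Labelled₁₂ (sym (ιB-injective-unlabelled z (inj₂ c) nl
                          (sym (just-injective (≡tr (sym (bL₂ j c bc)) bj))))) (j , bc))
    ... | nothing | nothing = just≢nothing (≡tr (sym bj) (≡tr (labB j)
                          (cong₂ (λ m1 m2 → Maybe.map ιB₁ m1 <∣> Maybe.map ιB₂ m2) ba bc)))

    unlabelled-preimage : ∀ e → ¬ Labelled L e → ∃[ z ] (¬ Labelled₁₂ z × ιB z ≡ e)
    unlabelled-preimage e nl with surjB e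
    ... | inj₁ (x , eq) = inj₁ x , (λ l → nl (subst (Labelled L) eq (ιB-Labelled (inj₁ x) l))) , eq
    ... | inj₂ (y , eq) = inj₂ y , (λ l → nl (subst (Labelled L) eq (ιB-Labelled (inj₂ y) l))) , eq

    E₁₂ : Blue₁₂ → Red₁₂ → Set
    E₁₂ (inj₁ a) (inj₁ y) = E (G L₁) a y ≡ true
    E₁₂ (inj₂ c) (inj₂ y) = E (G L₂) c y ≡ true
    E₁₂ _ _ = ⊥

    ιB-edge : ∀ z w → E₁₂ z w → E (G L) (ιB z) (ιR w) ≡ true
    ιB-edge (inj₁ a) (inj₁ y) e = Equivalence.from (edges _ _) (inj₁ (a , y , e , refl , refl))
    ιB-edge (inj₂ c) (inj₂ y) e = Equivalence.from (edges _ _) (inj₂ (c , y , e , refl , refl))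

    edge-preimage : ∀ z v → ¬ Labelled₁₂ z → E (G L) (ιB z) v ≡ true → ∃[ w ] (E₁₂ z w × ιR w ≡ v)
    edge-preimage z v nl ev with Equivalence.to (edges _ _) ev
    ... | inj₁ (x , y , exy , ex , ey) with ιB-injective-unlabelled z (inj₁ x) nl (sym ex)
    ...   | refl = inj₁ y , exy , ey
    edge-preimage z v nl ev | inj₂ (x , y , exy , ex , ey) with ιB-injective-unlabelled z (inj₂ x) nl (sym ex)
    ...   | refl = inj₂ y , exy , ey

  -- An unlabelled blue vertex of the glueing has a unique preimage, which determines its parent.
  module GlueForest {i₁ i₂} {L₁ L₂ L : LIG k} (gl : IsGlue L₁ L₂ L)
               (F₁ : LabelledElimForest i₁ L₁) (F₂ : LabelledElimForest i₂ L₂) (wg : WeakGuards L) where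
    open GlueFacts gl
    module A = LabelledElimForest F₁
    module B = LabelledElimForest F₂

    par₁₂ : Blue₁₂ → Maybe Blue₁₂
    par₁₂ (inj₁ a) = Maybe.map inj₁ (A.par a)
    par₁₂ (inj₂ c) = Maybe.map inj₂ (B.par c)

    dep₁₂ : Blue₁₂ → ℕ
    dep₁₂ (inj₁ a) = A.dep a
    dep₁₂ (inj₂ c) = B.dep c

    depRoot₁₂ : ∀ z → par₁₂ z ≡ nothing → dep₁₂ z ≡ 1
    depRoot₁₂ (inj₁ a) e = A.depRoot a (map≡nothing⇒ inj₁ e)
    depRoot₁₂ (inj₂ c) e = B.depRoot c (map≡nothing⇒ inj₂ e)

    par₁₂-just : ∀ z z' → par₁₂ z ≡ just z' → dep₁₂ z ≡ suc (dep₁₂ z') × ¬ Labelled₁₂ z'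
    par₁₂-just (inj₁ a) z' e with map≡just⇒ inj₁ {A.par a} e
    ... | p , pe , refl = A.depStep a p pe , A.parUnlab a p pe
    par₁₂-just (inj₂ c) z' e with map≡just⇒ inj₂ {B.par c} e
    ... | p , pe , refl = B.depStep c p pe , B.parUnlab c p pe

    height₁₂ : ∀ z → ¬ Labelled₁₂ z → dep₁₂ z ≤ i₁ ⊔ i₂
    height₁₂ (inj₁ a) nl = ≤-trans (A.height a nl) (m≤m⊔n i₁ i₂)
    height₁₂ (inj₂ c) nl = ≤-trans (B.height c nl) (m≤n⊔m i₁ i₂)

    UnlabelledPreimage : Fin (nB (G L)) → Set
    UnlabelledPreimage e = ∃[ z ] (¬ Labelled₁₂ z × ιB z ≡ e)

    unlabelledPreimage? : ∀ e → Dec (UnlabelledPreimage e)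
    unlabelledPreimage? e with FinP.any? (λ x → ¬? (Labelled? L₁ x) ×-dec (ιB₁ x FinP.≟ e))
    ... | yes (x , nl , eq) = yes (inj₁ x , nl , eq)
    ... | no n1 with FinP.any? (λ y → ¬? (Labelled? L₂ y) ×-dec (ιB₂ y FinP.≟ e))
    ...   | yes (y , nl , eq) = yes (inj₂ y , nl , eq)
    ...   | no n2 = no λ { (inj₁ x , nl , eq) → n1 (x , nl , eq) ; (inj₂ y , nl , eq) → n2 (y , nl , eq) }

    parH : ∀ e → Dec (Labelled L e) → Dec (UnlabelledPreimage e) → Maybe (Fin (nB (G L)))
    parH e (yes _) _ = nothing
    parH e (no _) (yes (z , _)) = Maybe.map ιB (par₁₂ z)
    parH e (no _) (no _) = nothing

    depH : ∀ e → Dec (Labelled L e) → Dec (UnlabelledPreimage e) → ℕ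
    depH e (yes _) _ = 1
    depH e (no _) (yes (z , _)) = dep₁₂ z
    depH e (no _) (no _) = 1

    parL : Fin (nB (G L)) → Maybe (Fin (nB (G L)))
    parL e = parH e (Labelled? L e) (unlabelledPreimage? e)

    depL : Fin (nB (G L)) → ℕ
    depL e = depH e (Labelled? L e) (unlabelledPreimage? e)

    parH-ι : ∀ z → ¬ Labelled₁₂ z → ∀ d1 d2 → parH (ιB z) d1 d2 ≡ Maybe.map ιB (par₁₂ z)
    parH-ι z nl (yes l) _ = ⊥-elim (ιB-unlabelled z nl l)
    parH-ι z nl (no _) (yes (z' , nl' , eq)) with ιB-injective-unlabelled z' z nl' eq
    ... | refl = refl
    parH-ι z nl (no _) (no np) = ⊥-elim (np (z , nl , refl))

    depH-ι : ∀ z → ¬ Labelled₁₂ z → ∀ d1 d2 → depH (ιB z) d1 d2 ≡ dep₁₂ z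
    depH-ι z nl (yes l) _ = ⊥-elim (ιB-unlabelled z nl l)
    depH-ι z nl (no _) (yes (z' , nl' , eq)) with ιB-injective-unlabelled z' z nl' eq
    ... | refl = refl
    depH-ι z nl (no _) (no np) = ⊥-elim (np (z , nl , refl))

    parL-ι : ∀ z → ¬ Labelled₁₂ z → parL (ιB z) ≡ Maybe.map ιB (par₁₂ z)
    parL-ι z nl = parH-ι z nl (Labelled? L (ιB z)) (unlabelledPreimage? (ιB z))

    depL-ι : ∀ z → ¬ Labelled₁₂ z → depL (ιB z) ≡ dep₁₂ z
    depL-ι z nl = depH-ι z nl (Labelled? L (ιB z)) (unlabelledPreimage? (ιB z))

    depRootH : ∀ e d1 d2 → parH e d1 d2 ≡ nothing → depH e d1 d2 ≡ 1
    depRootH e (yes _) _ _ = refl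
    depRootH e (no _) (yes (z , _)) h = depRoot₁₂ z (map≡nothing⇒ ιB h)
    depRootH e (no _) (no _) _ = refl

    depStepH : ∀ e d1 d2 p → parH e d1 d2 ≡ just p → depH e d1 d2 ≡ suc (depL p)
    depStepH e (yes _) _ p ()
    depStepH e (no _) (no _) p ()
    depStepH e (no _) (yes (z , nl , _)) p h with map≡just⇒ ιB h
    ... | z' , pz , refl with par₁₂-just z z' pz
    ... | ds , nl' = ≡tr ds (cong suc (sym (depL-ι z' nl')))

    labRootH : ∀ e d1 d2 → Labelled L e → parH e d1 d2 ≡ nothing
    labRootH e (yes _) _ _ = refl
    labRootH e (no nl) _ l = ⊥-elim (nl l)

    parUnlabH : ∀ e d1 d2 p → parH e d1 d2 ≡ just p → ¬ Labelled L p
    parUnlabH e (yes _) _ p ()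
    parUnlabH e (no _) (no _) p ()
    parUnlabH e (no _) (yes (z , nl , _)) p h with map≡just⇒ ιB h
    ... | z' , pz , refl = ιB-unlabelled z' (proj₂ (par₁₂-just z z' pz))

    depStepL : ∀ s p → parL s ≡ just p → depL s ≡ suc (depL p)
    depStepL s p = depStepH s (Labelled? L s) (unlabelledPreimage? s) p

    FL : Forest (nB (G L))
    FL = mkForest parL depL depStepL

    Anc-ι₁ : ∀ {z p} → ¬ Labelled₁₂ z → ∀ {q} → Anc A.forest p q → inj₁ q ≡ z → Anc FL (ιB₁ p) (ιB z)
    Anc-ι₁ nl here refl = here
    Anc-ι₁ nl (there {q = q} e a) refl =
      there (≡tr (parL-ι (inj₁ _) nl) (cong (Maybe.map ιB ∘ Maybe.map inj₁) e))
            (Anc-ι₁ (A.parUnlab _ _ e) a refl)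

    Anc-ι₂ : ∀ {z p} → ¬ Labelled₁₂ z → ∀ {q} → Anc B.forest p q → inj₂ q ≡ z → Anc FL (ιB₂ p) (ιB z)
    Anc-ι₂ nl here refl = here
    Anc-ι₂ nl (there {q = q} e a) refl =
      there (≡tr (parL-ι (inj₂ _) nl) (cong (Maybe.map ιB ∘ Maybe.map inj₂) e))
            (Anc-ι₂ (B.parUnlab _ _ e) a refl)

    strict₁₂ : ∀ zs zt w → ¬ Labelled₁₂ zs → ¬ Labelled₁₂ zt → E₁₂ zs w → E₁₂ zt w →
               SharedRedCovered L FL (ιB zs) (ιB zt) (ιR w)
    strict₁₂ (inj₁ a) (inj₁ a') (inj₁ y) nls nlt es et with A.strict a a' y nls nlt es et
    ... | inj₁ (p , pa , pa' , ep) =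
      inj₁ (ιB₁ p , Anc-ι₁ nls pa refl , Anc-ι₁ nlt pa' refl , ιB-edge (inj₁ p) (inj₁ y) ep)
    ... | inj₂ (e , le , ee) = inj₂ (ιB₁ e , ιB-Labelled (inj₁ e) le , ιB-edge (inj₁ e) (inj₁ y) ee)
    strict₁₂ (inj₂ a) (inj₂ a') (inj₂ y) nls nlt es et with B.strict a a' y nls nlt es et
    ... | inj₁ (p , pa , pa' , ep) =
      inj₁ (ιB₂ p , Anc-ι₂ nls pa refl , Anc-ι₂ nlt pa' refl , ιB-edge (inj₂ p) (inj₂ y) ep)
    ... | inj₂ (e , le , ee) = inj₂ (ιB₂ e , ιB-Labelled (inj₂ e) le , ιB-edge (inj₂ e) (inj₂ y) ee)
    strict₁₂ (inj₁ _) (inj₁ _) (inj₂ _) _ _ ()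
    strict₁₂ (inj₁ _) (inj₂ _) (inj₁ _) _ _ _ ()
    strict₁₂ (inj₁ _) (inj₂ _) (inj₂ _) _ _ ()
    strict₁₂ (inj₂ _) (inj₁ _) (inj₁ _) _ _ ()
    strict₁₂ (inj₂ _) (inj₁ _) (inj₂ _) _ _ _ ()
    strict₁₂ (inj₂ _) (inj₂ _) (inj₁ _) _ _ ()

    strictL : ∀ s t v → ¬ Labelled L s → ¬ Labelled L t → E (G L) s v ≡ true → E (G L) t v ≡ true →
              SharedRedCovered L FL s t v
    strictL s t v nls nlt es et with unlabelled-preimage s nls | unlabelled-preimage t nlt
    ... | zs , nzs , refl | zt , nzt , refl with edge-preimage zs v nzs es | edge-preimage zt v nzt et
    ... | ws , ews , refl | wt , ewt , eqt with ιR-identified⇒labelled ws wt (sym eqt)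
    ... | inj₁ refl = strict₁₂ zs zt ws nzs nzt ews ewt
    ... | inj₂ rl with ιR-labelled ws rl
    ... | j , rj with wg j (ιR ws) rj
    ... | e , le , ee = inj₂ (e , le , ee)

    heightL : ∀ s → ¬ Labelled L s → depL s ≤ i₁ ⊔ i₂
    heightL s nl with unlabelled-preimage s nl
    ... | z , nz , refl = subst (_≤ i₁ ⊔ i₂) (sym (depL-ι z nz)) (height₁₂ z nz)

    glued : LabelledElimForest (i₁ ⊔ i₂) L
    glued = record
      { par = parL ; dep = depL
      ; depRoot = λ s → depRootH s (Labelled? L s) (unlabelledPreimage? s)
      ; depStep = depStepL
      ; labRoot = λ e → labRootH e (Labelled? L e) (unlabelledPreimage? e)
      ; parUnlab = λ s → parUnlabH s (Labelled? L s) (unlabelledPreimage? s)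
      ; height = heightL
      ; strict = strictL }

  unlabelled-ancestor : ∀ {i L} (FI : LabelledElimForest i L) {p s} →
                        Anc (LabelledElimForest.forest FI) p s → ¬ Labelled L s → ¬ Labelled L p
  unlabelled-ancestor FI here nl = nl
  unlabelled-ancestor FI (there e a) nl = unlabelled-ancestor FI a (LabelledElimForest.parUnlab FI _ _ e)

  -- The c vertices that lose their label form a path from the new root fresh 0 down to
  -- fresh (c − 1), and every old root is hung below fresh (c − 1).
  module RemoveBlueForest {i} {L : LIG k} (X : Fin k → Bool) (FI : LabelledElimForest i L) where
    open LabelledElimForest FI
    L' : LIG k
    L' = removeBlue L X

    freshᵇ : Fin (nB (G L)) → Bool
    freshᵇ e = does (Labelled? L e) ∧ not (does (Labelled? L' e))

    c : ℕ
    c = card freshᵇ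

    fresh : Fin c → Fin (nB (G L))
    fresh = enum freshᵇ

    labelled'⇒labelled : ∀ e → Labelled L' e → Labelled L e
    labelled'⇒labelled e (j , eq) with X j
    ... | false = j , eq
    ... | true = ⊥-elim (just≢nothing (sym eq))

    freshᵇ⇒ : ∀ e → freshᵇ e ≡ true → Labelled L e × ¬ Labelled L' e
    freshᵇ⇒ e h with ∧≡true⇒× _ _ h
    ... | h1 , h2 = dec-true⁻¹ (Labelled? L e) h1 , dec-false⁻¹ (Labelled? L' e) (not≡true⇒≡false _ h2)

    ⇒freshᵇ : ∀ e → Labelled L e → ¬ Labelled L' e → freshᵇ e ≡ true
    ⇒freshᵇ e l nl = ∧-intro (dec-true (Labelled? L e) l) (cong not (dec-false (Labelled? L' e) nl))

    unlabelled⇒¬freshᵇ : ∀ e → ¬ Labelled L e → freshᵇ e ≡ false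
    unlabelled⇒¬freshᵇ e nl with freshᵇ e in h
    ... | false = refl
    ... | true = ⊥-elim (nl (proj₁ (freshᵇ⇒ e h)))

    labelled'⇒¬freshᵇ : ∀ e → Labelled L' e → freshᵇ e ≡ false
    labelled'⇒¬freshᵇ e l with freshᵇ e in h
    ... | false = refl
    ... | true = ⊥-elim (proj₂ (freshᵇ⇒ e h) l)

    fresh-unlabelled' : ∀ y → ¬ Labelled L' (fresh y)
    fresh-unlabelled' y = proj₂ (freshᵇ⇒ (fresh y) (enum-P freshᵇ y))

    positionH : ∀ e (β : Bool) → freshᵇ e ≡ β → Maybe (Fin c)
    positionH e true eq = just (index freshᵇ e eq)
    positionH e false _ = nothing

    position : Fin (nB (G L)) → Maybe (Fin c)
    position e = positionH e (freshᵇ e) refl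

    position-fresh : ∀ y → position (fresh y) ≡ just y
    position-fresh y = h (freshᵇ (fresh y)) refl
      where
      h : ∀ β (eq : freshᵇ (fresh y) ≡ β) → positionH (fresh y) β eq ≡ just y
      h true eq = cong just (index-enum freshᵇ y eq)
      h false eq = ⊥-elim (true≢false (≡tr (sym (enum-P freshᵇ y)) eq))

    position≡just⇒ : ∀ e y → position e ≡ just y → fresh y ≡ e
    position≡just⇒ e y = h (freshᵇ e) refl
      where
      h : ∀ β (eq : freshᵇ e ≡ β) → positionH e β eq ≡ just y → fresh y ≡ e
      h true eq refl = enum-index freshᵇ e eq
      h false eq ()

    ¬freshᵇ⇒position : ∀ e → freshᵇ e ≡ false → position e ≡ nothing
    ¬freshᵇ⇒position e nf = h (freshᵇ e) refl
      where
      h : ∀ β (eq : freshᵇ e ≡ β) → positionH e β eq ≡ nothing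
      h true eq = ⊥-elim (true≢false (≡tr (sym eq) nf))
      h false eq = refl

    freshᵇ⇒position : ∀ e → freshᵇ e ≡ true → ∃[ y ] (position e ≡ just y)
    freshᵇ⇒position e nt = h (freshᵇ e) refl
      where
      h : ∀ β (eq : freshᵇ e ≡ β) → ∃[ y ] (positionH e β eq ≡ just y)
      h true eq = _ , refl
      h false eq = ⊥-elim (true≢false (≡tr (sym nt) eq))

    hangRoots : Maybe (Fin (nB (G L))) → Maybe (Fin (nB (G L)))
    hangRoots (just p) = just p
    hangRoots nothing = Maybe.map fresh (finLast c)

    parH : ∀ e → Maybe (Fin c) → Dec (Labelled L e) → Maybe (Fin (nB (G L)))
    parH e (just y) _ = Maybe.map fresh (finPred y)
    parH e nothing (yes _) = nothing
    parH e nothing (no _) = hangRoots (par e)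

    depH : ∀ e → Maybe (Fin c) → Dec (Labelled L e) → ℕ
    depH e (just y) _ = suc (toℕ y)
    depH e nothing (yes _) = 1
    depH e nothing (no _) = dep e + c

    par' : Fin (nB (G L)) → Maybe (Fin (nB (G L)))
    par' e = parH e (position e) (Labelled? L e)

    dep' : Fin (nB (G L)) → ℕ
    dep' e = depH e (position e) (Labelled? L e)

    par'-fresh : ∀ e y → position e ≡ just y → par' e ≡ Maybe.map fresh (finPred y)
    par'-fresh e y eq = h (position e) (Labelled? L e) eq
      where
      h : ∀ m d → m ≡ just y → parH e m d ≡ Maybe.map fresh (finPred y)
      h (just y) d refl = refl

    dep'-fresh : ∀ e y → position e ≡ just y → dep' e ≡ suc (toℕ y)
    dep'-fresh e y eq = h (position e) (Labelled? L e) eq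
      where
      h : ∀ m d → m ≡ just y → depH e m d ≡ suc (toℕ y)
      h (just y) d refl = refl

    par'-old : ∀ e → ¬ Labelled L e → par' e ≡ hangRoots (par e)
    par'-old e nl = h (position e) (Labelled? L e) (¬freshᵇ⇒position e (unlabelled⇒¬freshᵇ e nl))
      where
      h : ∀ m d → m ≡ nothing → parH e m d ≡ hangRoots (par e)
      h nothing (yes l) _ = ⊥-elim (nl l)
      h nothing (no _) _ = refl

    dep'-old : ∀ e → ¬ Labelled L e → dep' e ≡ dep e + c
    dep'-old e nl = h (position e) (Labelled? L e) (¬freshᵇ⇒position e (unlabelled⇒¬freshᵇ e nl))
      where
      h : ∀ m d → m ≡ nothing → depH e m d ≡ dep e + c
      h nothing (yes l) _ = ⊥-elim (nl l)
      h nothing (no _) _ = refl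

    depRoot' : ∀ e → par' e ≡ nothing → dep' e ≡ 1
    depRoot' e = h (position e) (Labelled? L e)
      where
      h : ∀ m d → parH e m d ≡ nothing → depH e m d ≡ 1
      h (just y) d q = cong suc (finPred-nothing y (map≡nothing⇒ fresh q))
      h nothing (yes _) _ = refl
      h nothing (no _) q with par e in pe
      h nothing (no _) () | just p
      ... | nothing = ≡tr (cong₂ _+_ (depRoot e pe) (finLast-nothing c (map≡nothing⇒ fresh q))) refl

    depStep' : ∀ e p → par' e ≡ just p → dep' e ≡ suc (dep' p)
    depStep' e p = h (position e) (Labelled? L e)
      where
      h : ∀ m d → parH e m d ≡ just p → depH e m d ≡ suc (dep' p)
      h (just y) d q with map≡just⇒ fresh {finPred y} q
      ... | y' , py , refl = cong suc (≡tr (finPred-just y py) (sym (dep'-fresh (fresh y') y' (position-fresh y'))))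
      h nothing (yes _) ()
      h nothing (no nl) q with par e in pe
      h nothing (no nl) refl | just q' =
        ≡tr (cong (_+ c) (depStep e q' pe)) (cong suc (sym (dep'-old q' (parUnlab e q' pe))))
      ... | nothing with map≡just⇒ fresh {finLast c} q
      ... | yl , ly , refl =
        ≡tr (cong (_+ c) (depRoot e pe)) (cong suc (sym (≡tr (dep'-fresh (fresh yl) yl (position-fresh yl)) (finLast-just c ly))))

    labRoot' : ∀ e → Labelled L' e → par' e ≡ nothing
    labRoot' e l = h (position e) (Labelled? L e) (¬freshᵇ⇒position e (labelled'⇒¬freshᵇ e l))
      where
      h : ∀ m d → m ≡ nothing → parH e m d ≡ nothing
      h nothing (yes _) _ = refl
      h nothing (no nl) _ = ⊥-elim (nl (labelled'⇒labelled e l))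

    parUnlab' : ∀ s p → par' s ≡ just p → ¬ Labelled L' p
    parUnlab' s p = h (position s) (Labelled? L s)
      where
      h : ∀ m d → parH s m d ≡ just p → ¬ Labelled L' p
      h (just y) d q with map≡just⇒ fresh {finPred y} q
      ... | y' , _ , refl = fresh-unlabelled' y'
      h nothing (yes _) ()
      h nothing (no nl) q with par s in ps
      h nothing (no nl) refl | just q' = λ l → parUnlab s q' ps (labelled'⇒labelled q' l)
      ... | nothing with map≡just⇒ fresh {finLast c} q
      ... | yl , _ , refl = fresh-unlabelled' yl

    fresh-removedLabel : ∀ y → ∃[ j ] (X j ≡ true × b L j ≡ just (fresh y))
    fresh-removedLabel y with freshᵇ⇒ (fresh y) (enum-P freshᵇ y)
    ... | (j , bj) , nl' with X j in xj
    ... | true = j , xj , bj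
    ... | false = ⊥-elim (nl' (j , subst (λ β → (if β then nothing else b L j) ≡ just (fresh y)) (sym xj) bj))

    #fresh≤card : c ≤ card X
    #fresh≤card = FinP.injective⇒≤ {f = hf} inj
      where
      hf : Fin c → Fin (card X)
      hf y = index X (proj₁ (fresh-removedLabel y)) (proj₁ (proj₂ (fresh-removedLabel y)))
      inj : ∀ {y y'} → hf y ≡ hf y' → y ≡ y'
      inj {y} {y'} eq = enum-injective freshᵇ (just-injective (≡tr (sym (proj₂ (proj₂ (fresh-removedLabel y))))
                          (≡tr (cong (b L) jj) (proj₂ (proj₂ (fresh-removedLabel y'))))))
        where
        jj : proj₁ (fresh-removedLabel y) ≡ proj₁ (fresh-removedLabel y')
        jj = ≡tr (sym (enum-index X _ (proj₁ (proj₂ (fresh-removedLabel y)))))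
               (≡tr (cong (enum X) eq) (enum-index X _ (proj₁ (proj₂ (fresh-removedLabel y')))))

    height' : ∀ s → ¬ Labelled L' s → dep' s ≤ i + card X
    height' s nl' = h (position s) (Labelled? L s) refl
      where
      h : ∀ m d → position s ≡ m → depH s m d ≤ i + card X
      h (just y) d _ = ≤-trans (FinP.toℕ<n y) (≤-trans #fresh≤card (m≤n+m (card X) i))
      h nothing (yes l) q with freshᵇ⇒position s (⇒freshᵇ s l nl')
      ... | y , py = ⊥-elim (just≢nothing (≡tr (sym py) q))
      h nothing (no nl) _ = +-mono-≤ (height s nl) #fresh≤card

    F' : Forest (nB (G L))
    F' = mkForest par' dep' depStep'

    Anc-old : ∀ {p s} → Anc forest p s → ¬ Labelled L s → Anc F' p s
    Anc-old here _ = here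
    Anc-old (there {q = q} e a) nl = there (≡tr (par'-old _ nl) (cong hangRoots e)) (Anc-old a (parUnlab _ q e))

    fresh-chain : ∀ d y y' → toℕ y' ≡ toℕ y + d → Anc F' (fresh y) (fresh y')
    fresh-chain zero y y' eq with FinP.toℕ-injective (≡tr eq (+-identityʳ (toℕ y)))
    ... | refl = here
    fresh-chain (suc d) y y' eq with finPred-suc y' (toℕ y + d) (≡tr eq (+-suc (toℕ y) d))
    ... | y'' , py , ty = there (≡tr (par'-fresh (fresh y') y' (position-fresh y')) (cong (Maybe.map fresh) py))
                               (fresh-chain d y y'' ty)

    fresh-chain≤ : ∀ y y' → toℕ y ≤ toℕ y' → Anc F' (fresh y) (fresh y')
    fresh-chain≤ y y' le = fresh-chain (toℕ y' ∸ toℕ y) y y' (sym (m+[n∸m]≡n le))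

    fresh-above-old : ∀ y s → ¬ Labelled L s → Anc F' (fresh y) s
    fresh-above-old y s nl with Ancestry.rootAbove forest depth s
    ... | ρ , pρ , aρ with finLast-above y
    ... | yl , ly , le =
      Anc-trans (Anc-trans (fresh-chain≤ y yl le)
                   (there (≡tr (par'-old ρ (unlabelled-ancestor FI aρ nl))
                               (≡tr (cong hangRoots pρ) (cong (Maybe.map fresh) ly))) here))
                (Anc-old aρ nl)

    fresh-or-old : ∀ s → ¬ Labelled L' s → (∃[ y ] (fresh y ≡ s)) ⊎ ¬ Labelled L s
    fresh-or-old s nl' with Labelled? L s
    ... | no nl = inj₂ nl
    ... | yes l with freshᵇ⇒position s (⇒freshᵇ s l nl')
    ... | y , py = inj₁ (y , position≡just⇒ s y py)

    strict' : ∀ s t v → ¬ Labelled L' s → ¬ Labelled L' t → E (G L) s v ≡ true → E (G L) t v ≡ true →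
              SharedRedCovered L' F' s t v
    strict' s t v nls nlt es et with fresh-or-old s nls | fresh-or-old t nlt
    ... | inj₁ (ys , refl) | inj₁ (yt , refl) with toℕ ys ≤? toℕ yt
    ...   | yes le = inj₁ (fresh ys , here , fresh-chain≤ ys yt le , es)
    ...   | no nle = inj₁ (fresh yt , fresh-chain≤ yt ys (<⇒≤ (≰⇒> nle)) , here , et)
    strict' s t v nls nlt es et | inj₁ (ys , refl) | inj₂ nlt' = inj₁ (fresh ys , here , fresh-above-old ys t nlt' , es)
    strict' s t v nls nlt es et | inj₂ nls' | inj₁ (yt , refl) = inj₁ (fresh yt , fresh-above-old yt s nls' , here , et)
    strict' s t v nls nlt es et | inj₂ nls' | inj₂ nlt' with strict s t v nls' nlt' es et
    ... | inj₁ (p , ps , pt , ep) = inj₁ (p , Anc-old ps nls' , Anc-old pt nlt' , ep)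
    ... | inj₂ (e , le , ee) with Labelled? L' e
    ...   | yes le' = inj₂ (e , le' , ee)
    ...   | no nle' with freshᵇ⇒position e (⇒freshᵇ e le nle')
    ...     | y , py with position≡just⇒ e y py
    ...       | refl = inj₁ (fresh y , fresh-above-old y s nls' , fresh-above-old y t nlt' , ee)

    stacked : LabelledElimForest (i + card X) L'
    stacked = record
      { par = par' ; dep = dep' ; depRoot = depRoot' ; depStep = depStep'
      ; labRoot = labRoot' ; parUnlab = parUnlab' ; height = height' ; strict = strict' }


  RealGuards-removeRed : ∀ {L : LIG k} X → RealGuards L → RealGuards (removeRed L X)
  RealGuards-removeRed {L} X rg i v rv with X i
  ... | false = rg i v rv
  ... | true = ⊥-elim (just≢nothing (sym rv))

  RealGuards-removeBlue : ∀ {L : LIG k} X → (∀ j → X j ≡ true → InDom (b L) j × ¬ InImg (g L) j) →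
                          RealGuards L → RealGuards (removeBlue L X)
  RealGuards-removeBlue {L} X hX rg i v rv with rg i v rv
  ... | j , gj , e , bj , ev with X j in xj
  ... | true = ⊥-elim (proj₂ (hX j xj) (i , gj))
  ... | false = j , gj , e , subst (λ β → (if β then nothing else b L j) ≡ just e) (sym xj) bj , ev

  RealGuards-glue : ∀ {L₁ L₂ L : LIG k} → RealGuards L₁ → RealGuards L₂ → IsGlue L₁ L₂ L → RealGuards L
  RealGuards-glue {L₁} {L₂} {L} rg₁ rg₂ gl i v rv with r L₁ i in r1 | r L₂ i in r2
  ... | just y | _ with rg₁ i y r1
  ...   | j , gj , e , bj , ev =
          j , ≡tr (labG i) (cong (_<∣> g L₂ i) gj) , ιB₁ e , bL₁ j e bj ,
          subst (λ w → E (G L) (ιB₁ e) w ≡ true) (just-injective (≡tr (sym (rL₁ i y r1)) rv))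
                (ιB-edge (inj₁ e) (inj₁ y) ev)
    where open GlueFacts gl
  RealGuards-glue {L₁} {L₂} {L} rg₁ rg₂ gl i v rv | nothing | just y with rg₂ i y r2
  ...   | j , gj , e , bj , ev =
          j , ≡tr (labG i) (≡tr (cong (_<∣> g L₂ i) (is-just≡⇒nothing (domEq L₁ i) r1)) gj) , ιB₂ e , bL₂ j e bj ,
          subst (λ w → E (G L) (ιB₂ e) w ≡ true) (just-injective (≡tr (sym (rL₂ i y r2)) rv))
                (ιB-edge (inj₂ e) (inj₂ y) ev)
    where open GlueFacts gl
  RealGuards-glue {L₁} {L₂} {L} rg₁ rg₂ gl i v rv | nothing | nothing =
    ⊥-elim (just≢nothing (≡tr (sym rv) (≡tr (IsGlue.labR gl i)
      (cong₂ (λ m1 m2 → Maybe.map (IsGlue.ιR₁ gl) m1 <∣> Maybe.map (IsGlue.ιR₂ gl) m2) r1 r2))))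

  -- A red label outside dom f keeps its guard j from L; closedness of f gives j ∉ img f, so the
  -- transition does not remove the blue label j.
  RealGuards-transition : ∀ {L : LIG k} f → IsTransition L f → ∀ (S : Fin k → Bool) →
             (∀ j → (S j ≡ true) ⇔ (InImg f j × InDom (b L) j × InImg (g L) j)) →
             ∀ M → IsM f M → ∀ L' → IsGlue M (removeBlue L S) L' → RealGuards L → RealGuards L'
  RealGuards-transition {L} f tr S hS M isM L' gl rg i v rv with r M i in rm
  ... | just x with is-just≡⇒just (IsM.rDom isM i) rm
  ...   | j , fj with b M j in bm
  ...       | nothing = ⊥-elim (true≢false (≡tr (sym (Equivalence.from (IsM.bDom isM j) (i , fj)))
                          (cong is-just bm)))
  ...       | just e =
                j , ≡tr (labG i) (cong (_<∣> g L i) (≡tr (IsM.gEq isM i) fj)) , ιB₁ e , bL₁ j e bm ,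
                subst (λ w → E (G L') (ιB₁ e) w ≡ true) (just-injective (≡tr (sym (rL₁ i x rm)) rv))
                  (ιB-edge (inj₁ e) (inj₁ x)
                     (Equivalence.from (IsM.edges isM e x) (i , j , rm , bm , fj)))
    where open GlueFacts gl
  RealGuards-transition {L} f tr S hS M isM L' gl rg i v rv | nothing with r L i in rl
  ... | nothing = ⊥-elim (just≢nothing (≡tr (sym rv) (≡tr (IsGlue.labR gl i)
                    (cong₂ (λ m1 m2 → Maybe.map (IsGlue.ιR₁ gl) m1 <∣> Maybe.map (IsGlue.ιR₂ gl) m2) rm rl))))
  ... | just y with rg i y rl
  ...   | j , gj , e , bj , ev = j , g'-guard , ιB₂ e , bL₂ j e b'-guard ,
             subst (λ w → E (G L') (ιB₂ e) w ≡ true) (just-injective (≡tr (sym (rL₂ i y rl)) rv))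
               (ιB-edge (inj₂ e) (inj₂ y) ev)
    where
    open GlueFacts gl
    f-undefined : f i ≡ nothing
    f-undefined = is-just≡⇒nothing (IsM.rDom isM i) rm
    j∉img-f : ¬ InImg f j
    j∉img-f im = true≢false (≡tr (sym (IsTransition.closed tr i j gj im)) (cong is-just f-undefined))
    g'-guard : g L' i ≡ just j
    g'-guard = ≡tr (labG i) (≡tr (cong (_<∣> g L i) (≡tr (IsM.gEq isM i) f-undefined)) gj)
    S-false : S j ≡ false
    S-false with S j in Sj
    ... | false = refl
    ... | true = ⊥-elim (j∉img-f (proj₁ (Equivalence.to (hS j) Sj)))
    b'-guard : (if S j then nothing else b L j) ≡ just e
    b'-guard rewrite S-false = bj


  LabelledElimForest-removeRed : ∀ {i L} X → LabelledElimForest i L → LabelledElimForest i (removeRed L X)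
  LabelledElimForest-removeRed X FI = record
    { par = par ; dep = dep ; depRoot = depRoot ; depStep = depStep ; labRoot = labRoot
    ; parUnlab = parUnlab ; height = height ; strict = strict }
    where open LabelledElimForest FI

  gli⇒LabelledElimForest : ∀ {i L} → GLI k i L → RealGuards L × LabelledElimForest i L
  gli⇒LabelledElimForest (base L rg _ sb) = rg , allLabelled-forest sb
  gli⇒LabelledElimForest (lift d) with gli⇒LabelledElimForest d
  ... | rg , fi = rg , LabelledElimForest-lift fi
  gli⇒LabelledElimForest (glue d₁ d₂ _ L gl) with gli⇒LabelledElimForest d₁ | gli⇒LabelledElimForest d₂
  ... | rg₁ , fi₁ | rg₂ , fi₂ = rg , GlueForest.glued gl fi₁ fi₂ (RealGuards⇒WeakGuards {L = L} rg)
    where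
    rg : RealGuards L
    rg = RealGuards-glue rg₁ rg₂ gl
  gli⇒LabelledElimForest (GLI.trans d f tr S hS M isM L' gl) with gli⇒LabelledElimForest d
  ... | rg₀ , fi = rg , GlueForest.glued gl (allLabelled-forest (IsM.bSurj isM)) (RemoveBlueForest.stacked S fi)
                          (RealGuards⇒WeakGuards {L = L'} rg)
    where
    rg : RealGuards L'
    rg = RealGuards-transition f tr S hS M isM L' gl rg₀
  gli⇒LabelledElimForest (redRem {L = L} d X _) with gli⇒LabelledElimForest d
  ... | rg , fi = RealGuards-removeRed {L = L} X rg , LabelledElimForest-removeRed X fi
  gli⇒LabelledElimForest (blueRem {L = L} d X hX) with gli⇒LabelledElimForest d
  ... | rg , fi = RealGuards-removeBlue {L = L} X hX rg , RemoveBlueForest.stacked X fi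

  labelFree⇒shd≤ : ∀ (L : LIG k) → LabelFree L → LabelledElimForest k L → shd≤ (G L) k
  labelFree⇒shd≤ L (_ , noBlueLabels , _) FI = SF , height≤k
    where
    open LabelledElimForest FI
    unlabelled : ∀ s → ¬ Labelled L s
    unlabelled s (j , bj) = just≢nothing (≡tr (sym bj) (noBlueLabels j))
    commonAncestor : ∀ s t v → E (G L) s v ≡ true → E (G L) t v ≡ true →
                     ∃[ p ] (Anc forest p s × Anc forest p t × E (G L) p v ≡ true)
    commonAncestor s t v es et with strict s t v (unlabelled s) (unlabelled t) es et
    ... | inj₁ covered = covered
    ... | inj₂ (e , le , _) = ⊥-elim (unlabelled e le)
    strict' : ∀ s t v → E (G L) s v ≡ true → E (G L) t v ≡ true →
              ∃[ c ] (IsLcv forest s t c ×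
                      (∀ w → E (G L) s w ≡ true → E (G L) t w ≡ true → ∃[ p ] (Anc forest p c × E (G L) p w ≡ true)))
    strict' s t v es et with commonAncestor s t v es et
    ... | _ , ps , pt , _ with Ancestry.lcv-exists forest depth ps pt
    ...   | c , lcv@(_ , _ , below) = c , lcv , cover
      where
      cover : ∀ w → E (G L) s w ≡ true → E (G L) t w ≡ true → ∃[ p ] (Anc forest p c × E (G L) p w ≡ true)
      cover w ew ew' with commonAncestor s t w ew ew'
      ... | p , ps' , pt' , ep = p , below p ps' pt' , ep
    SF : StrictElimForest (G L)
    SF = record { nF = nB (G L) ; F = forest ; Γ = ⤖-id _ ; strict = strict' }
    height≤k : HeightAtMost forest k
    height≤k s m pl = subst (_≤ k) (sym (Ancestry.PathLen⇒≡dep forest depth pl)) (height s (unlabelled s))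

open Soundness using (gli⇒LabelledElimForest; labelFree⇒shd≤)

shd≤-Iso : ∀ {I J h} → Iso I J → shd≤ I h → shd≤ J h
shd≤-Iso {I} {J} iso (SF , height≤h) = SF' , height≤h
  where
  open Iso iso
  open StrictElimForest SF
  InΓ̂' : Fin nF → Fin (nR J) → Set
  InΓ̂' t v = E J (Bijection.to φB (Bijection.to Γ t)) v ≡ true
  red-onto : ∀ v → ∃[ x ] (Bijection.to φR x ≡ v)
  red-onto v with proj₂ (Bijection.bijective φR) v
  ... | x , hx = x , hx refl
  strict' : ∀ s t v → InΓ̂' s v → InΓ̂' t v →
            ∃[ c ] (IsLcv F s t c × (∀ w → InΓ̂' s w → InΓ̂' t w → ∃[ p ] (Anc F p c × InΓ̂' p w)))
  strict' s t v es et with red-onto v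
  ... | x , refl with strict s t x (≡tr (edges _ _) es) (≡tr (edges _ _) et)
  ...   | c , lcv , cover = c , lcv , cover'
    where
    cover' : ∀ w → InΓ̂' s w → InΓ̂' t w → ∃[ p ] (Anc F p c × InΓ̂' p w)
    cover' w ew ew' with red-onto w
    ... | y , refl with cover y (≡tr (edges _ _) ew) (≡tr (edges _ _) ew')
    ...   | p , a , ep = p , a , ≡tr (sym (edges _ _)) ep
  SF' : StrictElimForest J
  SF' = record { nF = nF ; F = F ; Γ = φB ⤖-∘ Γ ; strict = strict' }


module Completeness {k : ℕ} (J : IG) (SF : StrictElimForest J)
                (height≤k : HeightAtMost (StrictElimForest.F SF) k) where
  open StrictElimForest SF

  n : ℕ
  n = nF
  m : ℕ
  m = nR J

  E' : Fin n → Fin m → Bool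
  E' s v = E J (Bijection.to Γ s) v

  depthF : Depth F
  depthF = depthOf F
  open Depth depthF
  open Ancestry F depthF

  dep≤k : ∀ s → dep s ≤ k
  dep≤k s = height≤k s (dep s) (PathLen-dep s)

  Γ-surjective : ∀ e → ∃[ s ] (Bijection.to Γ s ≡ e)
  Γ-surjective e with proj₂ (Bijection.bijective Γ) e
  ... | s , h = s , h refl

  Γ-injective : ∀ {s t} → Bijection.to Γ s ≡ Bijection.to Γ t → s ≡ t
  Γ-injective = proj₁ (Bijection.bijective Γ)

  red-covered : ∀ v → ∃[ s ] (E' s v ≡ true)
  red-covered v with covered J v
  ... | e , ev with Γ-surjective e
  ... | s , refl = s , ev

  top-exists : ∀ v → ∃[ τ ] (E' τ v ≡ true × (∀ s → E' s v ≡ true → Anc F τ s))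
  top-exists v with red-covered v
  ... | s₀ , e₀ with argmin (λ s → E' s v) dep s₀ e₀
  ... | τ , eτ , shallowest = τ , eτ , λ s es → τ-above s es
    where
    τ-above : ∀ s → E' s v ≡ true → Anc F τ s
    τ-above s es with strict τ s v eτ es
    ... | c , (cτ , cs , _) , cover with cover v eτ es
    ... | p , pc , ep with Anc-dep≡⇒≡ (Anc-trans pc cτ) (≤-antisym (Anc⇒dep≤ (Anc-trans pc cτ)) (shallowest p ep))
    ... | refl = Anc-trans pc cs

  top : Fin m → Fin n
  top v = proj₁ (top-exists v)

  top-E : ∀ v → E' (top v) v ≡ true
  top-E v = proj₁ (proj₂ (top-exists v))

  top-anc : ∀ v s → E' s v ≡ true → Anc F (top v) s
  top-anc v = proj₂ (proj₂ (top-exists v))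

  -- A node of depth d carries blue label d, i.e. the element d ∸ 1 of Fin k.
  depthLabel<k : ∀ s → dep s ∸ 1 < k
  depthLabel<k s with dep s | dep≥1 s | dep≤k s
  ... | suc d | _ | le = le

  depthLabel : Fin n → Fin k
  depthLabel s = fromℕ< (depthLabel<k s)

  depthLabel-suc : ∀ s → suc (toℕ (depthLabel s)) ≡ dep s
  depthLabel-suc s = ≡tr (cong suc (FinP.toℕ-fromℕ< (depthLabel<k s))) (h (dep s) (dep≥1 s))
    where
    h : ∀ d → 1 ≤ d → suc (d ∸ 1) ≡ d
    h (suc d) _ = refl

  guard : Fin m → Fin k
  guard v = depthLabel (top v)

  -- onPath q a says a ∈ P(q); q = nothing is a virtual root above all roots, with P empty.
  onPath : Maybe (Fin n) → Fin n → Bool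
  onPath nothing x = false
  onPath (just t) x = ancᵇ x t

  onPath⇒Anc : ∀ t a → onPath (just t) a ≡ true → Anc F a t
  onPath⇒Anc t a h = dec-true⁻¹ (Anc? a t) h

  Anc⇒onPath : ∀ t a → Anc F a t → onPath (just t) a ≡ true
  Anc⇒onPath t a h = dec-true (Anc? a t) h

  atLabelᵇ : Maybe (Fin n) → Fin k → Fin n → Bool
  atLabelᵇ q j a = onPath q a ∧ does (dep a ≟ suc (toℕ j))

  pathLabel : Maybe (Fin n) → Fin k → Maybe (Fin n)
  pathLabel q j = first (atLabelᵇ q j)

  pathLabel-sound : ∀ q j a → pathLabel q j ≡ just a → onPath q a ≡ true × dep a ≡ suc (toℕ j)
  pathLabel-sound q j a h with ∧≡true⇒× _ _ (first-sound (atLabelᵇ q j) h)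
  ... | h1 , h2 = h1 , dec-true⁻¹ (dep a ≟ suc (toℕ j)) h2

  pathLabel-complete : ∀ q j a → onPath q a ≡ true → dep a ≡ suc (toℕ j) → pathLabel q j ≡ just a
  pathLabel-complete nothing j a () _
  pathLabel-complete (just t) j a pa da
    with first-complete (atLabelᵇ (just t) j) a (∧-intro pa (dec-true (dep a ≟ suc (toℕ j)) da))
  ... | a' , h with pathLabel-sound (just t) j a' h
  ... | pa' , da' with Anc-sameDepth⇒≡ (onPath⇒Anc t a' pa') (onPath⇒Anc t a pa) (≡tr da' (sym da))
  ... | refl = h

  pathLabel-depthLabel : ∀ q a → onPath q a ≡ true → pathLabel q (depthLabel a) ≡ just a
  pathLabel-depthLabel q a pa = pathLabel-complete q (depthLabel a) a pa (sym (depthLabel-suc a))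

  onPath-Anc : ∀ q a b → Anc F a b → onPath q b ≡ true → onPath q a ≡ true
  onPath-Anc nothing a b _ ()
  onPath-Anc (just t) a b ab pb = Anc⇒onPath t a (Anc-trans ab (onPath⇒Anc t b pb))

  pathLabel-guard : ∀ q v a → onPath q a ≡ true → E' a v ≡ true → pathLabel q (guard v) ≡ just (top v)
  pathLabel-guard q v a pa ea = pathLabel-depthLabel q (top v) (onPath-Anc q (top v) a (top-anc v a ea) pa)

  -- A k-labeled subgraph of J with blue vertices named by forest nodes.  A labelled red
  -- vertex v carries red label toℕ v and guard `guard v`.
  record Sketch : Set where
    constructor sketch
    field
      reds : Fin m → Bool
      blues : Fin n → Bool
      labReds : Fin m → Bool
      blueLab : Fin k → Maybe (Fin n)
  open Sketch public

  record Realises (Dt : Sketch) (L : LIG k) : Set where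
    field
      eR : Fin (nR (G L)) → Fin m
      eR-inj : ∀ {x y} → eR x ≡ eR y → x ≡ y
      eR-in : ∀ x → reds Dt (eR x) ≡ true
      eR-sur : ∀ v → reds Dt v ≡ true → ∃[ x ] (eR x ≡ v)
      eB : Fin (nB (G L)) → Fin n
      eB-inj : ∀ {x y} → eB x ≡ eB y → x ≡ y
      eB-in : ∀ x → blues Dt (eB x) ≡ true
      eB-sur : ∀ a → blues Dt a ≡ true → ∃[ x ] (eB x ≡ a)
      eE : ∀ e x → E (G L) e x ≡ E' (eB e) (eR x)
      labReds⊆reds : ∀ v → labReds Dt v ≡ true → reds Dt v ≡ true
      r-sound : ∀ i x → r L i ≡ just x → labReds Dt (eR x) ≡ true × toℕ (eR x) ≡ i
      r-complete : ∀ x → labReds Dt (eR x) ≡ true → r L (toℕ (eR x)) ≡ just x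
      b-sound : ∀ j y → b L j ≡ just y → blueLab Dt j ≡ just (eB y)
      b-complete : ∀ j a → blueLab Dt j ≡ just a → ∃[ y ] (b L j ≡ just y)
      g-guard : ∀ i x → r L i ≡ just x → g L i ≡ just (guard (eR x))

  record WellFormed (Dt : Sketch) : Set where
    field
      labReds⊆reds : ∀ v → labReds Dt v ≡ true → reds Dt v ≡ true
      blueLab⊆blues : ∀ j a → blueLab Dt j ≡ just a → blues Dt a ≡ true
      reds-covered : ∀ v → reds Dt v ≡ true → ∃[ a ] (blues Dt a ≡ true × E' a v ≡ true)

  module Build (Dt : Sketch) (w : WellFormed Dt) where
    sR : Fin m → Bool
    sR = reds Dt
    sB : Fin n → Bool
    sB = blues Dt

    mkG : IG
    mkG = record { nR = card sR ; nB = card sB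
                 ; E = λ e x → E' (enum sB e) (enum sR x) ; covered = cv }
      where
      cv : ∀ x → ∃[ e ] (E' (enum sB e) (enum sR x) ≡ true)
      cv x with WellFormed.reds-covered w (enum sR x) (enum-P sR x)
      ... | a , sa , ea = index sB a sa , subst (λ z → E' z (enum sR x) ≡ true) (sym (enum-index sB a sa)) ea

    rP : ℕ → Fin (card sR) → Bool
    rP i x = does (toℕ (enum sR x) ≟ i) ∧ labReds Dt (enum sR x)

    mkr : ℕ → Maybe (Fin (card sR))
    mkr i = first (rP i)

    bP : Fin k → Fin (card sB) → Bool
    bP j y = does (_≟ᴹ_ (blueLab Dt j) (just (enum sB y)))

    mkb : Fin k → Maybe (Fin (card sB))
    mkb j = first (bP j)

    mkg : ℕ → Maybe (Fin k)
    mkg i = Maybe.map (guard ∘ enum sR) (mkr i)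

    rP-sound : ∀ i x → rP i x ≡ true → labReds Dt (enum sR x) ≡ true × toℕ (enum sR x) ≡ i
    rP-sound i x h with ∧≡true⇒× _ _ h
    ... | h1 , h2 = h2 , dec-true⁻¹ (toℕ (enum sR x) ≟ i) h1

    mkr-finite : ∀ i → m ≤ i → mkr i ≡ nothing
    mkr-finite i le with mkr i in eq
    ... | nothing = refl
    ... | just x with rP-sound i x (first-sound (rP i) eq)
    ... | _ , ti = ⊥-elim (<-irrefl refl (≤-trans (subst (_< m) ti (FinP.toℕ<n (enum sR x))) le))

    built : LIG k
    built = record { G = mkG ; r = mkr ; b = mkb ; g = mkg
                ; domEq = λ i → is-just-map (guard ∘ enum sR) (mkr i) ; fin = m , mkr-finite }

    built-realises : Realises Dt built
    built-realises = record
      { eR = enum sR ; eR-inj = enum-injective sR ; eR-in = enum-P sR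
      ; eR-sur = λ v p → index sR v p , enum-index sR v p
      ; eB = enum sB ; eB-inj = enum-injective sB ; eB-in = enum-P sB
      ; eB-sur = λ a p → index sB a p , enum-index sB a p
      ; eE = λ e x → refl
      ; labReds⊆reds = WellFormed.labReds⊆reds w
      ; r-sound = λ i x h → rP-sound i x (first-sound (rP i) h)
      ; r-complete = r-complete'
      ; b-sound = λ j y h → dec-true⁻¹ (_≟ᴹ_ (blueLab Dt j) (just (enum sB y))) (first-sound (bP j) h)
      ; b-complete = b-complete'
      ; g-guard = λ i x h → cong (Maybe.map (guard ∘ enum sR)) h }
      where
      r-complete' : ∀ x → labReds Dt (enum sR x) ≡ true → mkr (toℕ (enum sR x)) ≡ just x
      r-complete' x lx
        with first-complete (rP (toℕ (enum sR x))) x (∧-intro (dec-true (toℕ (enum sR x) ≟ toℕ (enum sR x)) refl) lx)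
      ... | x' , h with rP-sound _ x' (first-sound (rP (toℕ (enum sR x))) h)
      ... | _ , tx with enum-injective sR (FinP.toℕ-injective tx)
      ... | refl = h
      b-complete' : ∀ j a → blueLab Dt j ≡ just a → ∃[ y ] (mkb j ≡ just y)
      b-complete' j a la = first-complete (bP j) (index sB a (WellFormed.blueLab⊆blues w j a la))
        (dec-true (_≟ᴹ_ (blueLab Dt j) (just (enum sB (index sB a (WellFormed.blueLab⊆blues w j a la)))))
           (≡tr la (cong just (sym (enum-index sB a (WellFormed.blueLab⊆blues w j a la))))))

  record SketchEq (D₁ D₂ : Sketch) : Set where
    field
      reds≡ : ∀ v → reds D₁ v ≡ reds D₂ v
      blues≡ : ∀ a → blues D₁ a ≡ blues D₂ a
      labReds≡ : ∀ v → labReds D₁ v ≡ labReds D₂ v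
      blueLab≡ : ∀ j → blueLab D₁ j ≡ blueLab D₂ j

  Realises-ext : ∀ {D₁ D₂ L} → SketchEq D₁ D₂ → Realises D₁ L → Realises D₂ L
  Realises-ext {D₁} {D₂} {L} de R = record
    { eR = eR ; eR-inj = eR-inj ; eR-in = λ x → ≡tr (sym (reds≡ _)) (eR-in x)
    ; eR-sur = λ v p → eR-sur v (≡tr (reds≡ v) p)
    ; eB = eB ; eB-inj = eB-inj ; eB-in = λ x → ≡tr (sym (blues≡ _)) (eB-in x)
    ; eB-sur = λ a p → eB-sur a (≡tr (blues≡ a) p)
    ; eE = eE
    ; labReds⊆reds = λ v p → ≡tr (sym (reds≡ v)) (labReds⊆reds v (≡tr (labReds≡ v) p))
    ; r-sound = λ i x h → ≡tr (sym (labReds≡ _)) (proj₁ (r-sound i x h)) , proj₂ (r-sound i x h)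
    ; r-complete = λ x p → r-complete x (≡tr (labReds≡ _) p)
    ; b-sound = λ j y h → ≡tr (sym (blueLab≡ j)) (b-sound j y h)
    ; b-complete = λ j a p → b-complete j a (≡tr (blueLab≡ j) p)
    ; g-guard = g-guard }
    where
    open Realises R
    open SketchEq de

  module RealisesRemoveRed {Dt L} (R : Realises Dt L) (keptReds : Fin m → Bool)
                           (kept⊆ : ∀ v → keptReds v ≡ true → labReds Dt v ≡ true) where
    open Realises R
    dropᵇ : Maybe (Fin (nR (G L))) → Bool
    dropᵇ nothing = false
    dropᵇ (just x) = not (keptReds (eR x))

    dropped : ℕ → Bool
    dropped i = dropᵇ (r L i)

    dropped-labelled : ∀ j → dropped j ≡ true → InDom (r L) j
    dropped-labelled j h with r L j
    ... | just _ = refl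
    ... | nothing = ⊥-elim (true≢false (sym h))

    Dt' : Sketch
    Dt' = sketch (reds Dt) (blues Dt) keptReds (blueLab Dt)

    realises' : Realises Dt' (removeRed L dropped)
    realises' = record
      { eR = eR ; eR-inj = eR-inj ; eR-in = eR-in ; eR-sur = eR-sur
      ; eB = eB ; eB-inj = eB-inj ; eB-in = eB-in ; eB-sur = eB-sur ; eE = eE
      ; labReds⊆reds = λ v p → labReds⊆reds v (kept⊆ v p)
      ; r-sound = r-sound' ; r-complete = r-complete' ; b-sound = b-sound ; b-complete = b-complete ; g-guard = g-guard' }
      where
      r-sound' : ∀ i x → (if dropped i then nothing else r L i) ≡ just x → keptReds (eR x) ≡ true × toℕ (eR x) ≡ i
      r-sound' i x h with dropped i in xi
      ... | true = ⊥-elim (just≢nothing (sym h))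
      ... | false = not≡false⇒≡true _ (≡tr (sym (cong dropᵇ h)) xi) , proj₂ (r-sound i x h)
      r-complete' : ∀ x → keptReds (eR x) ≡ true → (if dropped (toℕ (eR x)) then nothing else r L (toℕ (eR x))) ≡ just x
      r-complete' x lx = subst (λ β → (if β then nothing else r L (toℕ (eR x))) ≡ just x)
                   (sym (≡tr (cong dropᵇ (r-complete x (kept⊆ _ lx))) (cong not lx))) (r-complete x (kept⊆ _ lx))
      g-guard' : ∀ i x → (if dropped i then nothing else r L i) ≡ just x →
                 (if dropped i then nothing else g L i) ≡ just (guard (eR x))
      g-guard' i x h with dropped i
      ... | true = ⊥-elim (just≢nothing (sym h))
      ... | false = g-guard i x h

  module RealisesRemoveBlue {Dt L} (R : Realises Dt L) (Y : Fin k → Bool) (blueLab' : Fin k → Maybe (Fin n))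
                 (blueLab'≡ : ∀ j → blueLab' j ≡ (if Y j then nothing else blueLab Dt j)) where
    open Realises R
    Dt' : Sketch
    Dt' = sketch (reds Dt) (blues Dt) (labReds Dt) blueLab'

    blueLab'-just : ∀ j a → blueLab' j ≡ just a → Y j ≡ false × blueLab Dt j ≡ just a
    blueLab'-just j a h with Y j in yj
    ... | true = ⊥-elim (just≢nothing (≡tr (sym h) (≡tr (blueLab'≡ j) (cong (λ β → if β then nothing else blueLab Dt j) yj))))
    ... | false = refl , ≡tr (sym (≡tr (blueLab'≡ j) (cong (λ β → if β then nothing else blueLab Dt j) yj))) h

    realises' : Realises Dt' (removeBlue L Y)
    realises' = record
      { eR = eR ; eR-inj = eR-inj ; eR-in = eR-in ; eR-sur = eR-sur
      ; eB = eB ; eB-inj = eB-inj ; eB-in = eB-in ; eB-sur = eB-sur ; eE = eE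
      ; labReds⊆reds = labReds⊆reds
      ; r-sound = r-sound ; r-complete = r-complete ; b-sound = b-sound' ; b-complete = b-complete' ; g-guard = g-guard }
      where
      b-sound' : ∀ j y → (if Y j then nothing else b L j) ≡ just y → blueLab' j ≡ just (eB y)
      b-sound' j y h with Y j in yj
      ... | true = ⊥-elim (just≢nothing (sym h))
      ... | false = ≡tr (≡tr (blueLab'≡ j) (cong (λ β → if β then nothing else blueLab Dt j) yj)) (b-sound j y h)
      b-complete' : ∀ j a → blueLab' j ≡ just a → ∃[ y ] ((if Y j then nothing else b L j) ≡ just y)
      b-complete' j a h with blueLab'-just j a h
      ... | yf , la with b-complete j a la
      ... | y , bj = y , subst (λ β → (if β then nothing else b L j) ≡ just y) (sym yf) bj

  Realises-compatible : ∀ {D₁ D₂ L₁ L₂} → Realises D₁ L₁ → Realises D₂ L₂ → Compatible (g L₁) (g L₂)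
  Realises-compatible {L₁ = L₁} {L₂} R₁ R₂ i a c ga gc
    with is-just≡⇒just (sym (domEq L₁ i)) ga | is-just≡⇒just (sym (domEq L₂ i)) gc
  ... | x , rx | y , ry =
    just-injective (≡tr (sym ga) (≡tr (Realises.g-guard R₁ i x rx)
      (≡tr (cong (λ z → just (guard z))
                 (FinP.toℕ-injective (≡tr (proj₂ (Realises.r-sound R₁ i x rx)) (sym (proj₂ (Realises.r-sound R₂ i y ry))))))
        (≡tr (sym (Realises.g-guard R₂ i y ry)) gc))))

  record GlueCondition (D₁ D₂ Dt : Sketch) : Set where
    field
      reds-∪ : ∀ v → reds Dt v ≡ reds D₁ v ∨ reds D₂ v
      blues-∪ : ∀ a → blues Dt a ≡ blues D₁ a ∨ blues D₂ a
      labReds-∪ : ∀ v → labReds Dt v ≡ labReds D₁ v ∨ labReds D₂ v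
      blueLab₁≡ : ∀ j → blueLab D₁ j ≡ blueLab Dt j
      blueLab₂≡ : ∀ j → blueLab D₂ j ≡ blueLab Dt j
      sharedReds-labelled : ∀ v → reds D₁ v ≡ true → reds D₂ v ≡ true → labReds D₁ v ≡ true × labReds D₂ v ≡ true
      sharedBlues-labelled : ∀ a → blues D₁ a ≡ true → blues D₂ a ≡ true → ∃[ j ] (blueLab Dt j ≡ just a)
      edge-within-part : ∀ a v → blues Dt a ≡ true → reds Dt v ≡ true → E' a v ≡ true →
              (blues D₁ a ≡ true × reds D₁ v ≡ true) ⊎ (blues D₂ a ≡ true × reds D₂ v ≡ true)

  module RealisesGlue {D₁ D₂ Dt L₁ L₂} (R₁ : Realises D₁ L₁) (R₂ : Realises D₂ L₂)
                      (w : WellFormed Dt) (gc : GlueCondition D₁ D₂ Dt) where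
    open Build Dt w
    module R₁ = Realises R₁
    module R₂ = Realises R₂
    module RR = Realises built-realises
    open GlueCondition gc

    inR₁ : ∀ x → sR (R₁.eR x) ≡ true
    inR₁ x = ≡tr (reds-∪ _) (∨-introˡ _ _ (R₁.eR-in x))
    inR₂ : ∀ x → sR (R₂.eR x) ≡ true
    inR₂ x = ≡tr (reds-∪ _) (∨-introʳ _ _ (R₂.eR-in x))
    inB₁ : ∀ x → sB (R₁.eB x) ≡ true
    inB₁ x = ≡tr (blues-∪ _) (∨-introˡ _ _ (R₁.eB-in x))
    inB₂ : ∀ x → sB (R₂.eB x) ≡ true
    inB₂ x = ≡tr (blues-∪ _) (∨-introʳ _ _ (R₂.eB-in x))

    ιR₁ : Fin (nR (G L₁)) → Fin (card sR)
    ιR₁ x = index sR (R₁.eR x) (inR₁ x)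
    ιR₂ : Fin (nR (G L₂)) → Fin (card sR)
    ιR₂ x = index sR (R₂.eR x) (inR₂ x)
    ιB₁ : Fin (nB (G L₁)) → Fin (card sB)
    ιB₁ x = index sB (R₁.eB x) (inB₁ x)
    ιB₂ : Fin (nB (G L₂)) → Fin (card sB)
    ιB₂ x = index sB (R₂.eB x) (inB₂ x)

    enR₁ : ∀ x → enum sR (ιR₁ x) ≡ R₁.eR x
    enR₁ x = enum-index sR _ (inR₁ x)
    enR₂ : ∀ x → enum sR (ιR₂ x) ≡ R₂.eR x
    enR₂ x = enum-index sR _ (inR₂ x)
    enB₁ : ∀ x → enum sB (ιB₁ x) ≡ R₁.eB x
    enB₁ x = enum-index sB _ (inB₁ x)
    enB₂ : ∀ x → enum sB (ιB₂ x) ≡ R₂.eB x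
    enB₂ x = enum-index sB _ (inB₂ x)

    ιRZ : Fin (nR (G L₁)) ⊎ Fin (nR (G L₂)) → Fin (card sR)
    ιRZ = [ ιR₁ , ιR₂ ]′
    ιBZ : Fin (nB (G L₁)) ⊎ Fin (nB (G L₂)) → Fin (card sB)
    ιBZ = [ ιB₁ , ιB₂ ]′
    eRZ : Fin (nR (G L₁)) ⊎ Fin (nR (G L₂)) → Fin m
    eRZ = [ R₁.eR , R₂.eR ]′
    eBZ : Fin (nB (G L₁)) ⊎ Fin (nB (G L₂)) → Fin n
    eBZ = [ R₁.eB , R₂.eB ]′

    enRZ : ∀ z → enum sR (ιRZ z) ≡ eRZ z
    enRZ (inj₁ x) = enR₁ x
    enRZ (inj₂ x) = enR₂ x
    enBZ : ∀ z → enum sB (ιBZ z) ≡ eBZ z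
    enBZ (inj₁ x) = enB₁ x
    enBZ (inj₂ x) = enB₂ x

    genR : ∀ {z z'} → GenId (r L₁) (r L₂) z z' → ιRZ z ≡ ιRZ z'
    genR (gen j a c ra rc) = enum-injective sR (≡tr (enR₁ a) (≡tr (FinP.toℕ-injective
      (≡tr (proj₂ (R₁.r-sound j a ra)) (sym (proj₂ (R₂.r-sound j c rc))))) (sym (enR₂ c))))

    genB : ∀ {z z'} → GenId (b L₁) (b L₂) z z' → ιBZ z ≡ ιBZ z'
    genB (gen j a c ba bc) = enum-injective sB (≡tr (enB₁ a) (≡tr (just-injective
      (≡tr (sym (≡tr (sym (blueLab₁≡ j)) (R₁.b-sound j a ba))) (≡tr (sym (blueLab₂≡ j)) (R₂.b-sound j c bc)))) (sym (enB₂ c))))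

    starR : ∀ {z z'} → EqClosure (GenId (r L₁) (r L₂)) z z' → ιRZ z ≡ ιRZ z'
    starR ε = refl
    starR (fwd x ◅ rest) = ≡tr (genR x) (starR rest)
    starR (bwd x ◅ rest) = ≡tr (sym (genR x)) (starR rest)

    starB : ∀ {z z'} → EqClosure (GenId (b L₁) (b L₂)) z z' → ιBZ z ≡ ιBZ z'
    starB ε = refl
    starB (fwd x ◅ rest) = ≡tr (genB x) (starB rest)
    starB (bwd x ◅ rest) = ≡tr (sym (genB x)) (starB rest)

    sharedR : ∀ x y → R₁.eR x ≡ R₂.eR y → GenId (r L₁) (r L₂) (inj₁ x) (inj₂ y)
    sharedR x y eq with sharedReds-labelled (R₁.eR x) (R₁.eR-in x) (subst (λ z → reds D₂ z ≡ true) (sym eq) (R₂.eR-in y))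
    ... | l1 , l2 = gen (toℕ (R₁.eR x)) x y (R₁.r-complete x l1)
                      (subst (λ i → r L₂ i ≡ just y) (cong toℕ (sym eq)) (R₂.r-complete y (subst (λ z → labReds D₂ z ≡ true) eq l2)))

    sharedB : ∀ x y → R₁.eB x ≡ R₂.eB y → GenId (b L₁) (b L₂) (inj₁ x) (inj₂ y)
    sharedB x y eq with sharedBlues-labelled (R₁.eB x) (R₁.eB-in x) (subst (λ z → blues D₂ z ≡ true) (sym eq) (R₂.eB-in y))
    ... | j , lj with R₁.b-complete j _ (≡tr (blueLab₁≡ j) lj) | R₂.b-complete j _ (≡tr (blueLab₂≡ j) (≡tr lj (cong just eq)))
    ... | x' , bx | y' , by = gen j x y (subst (λ z → b L₁ j ≡ just z) ex bx) (subst (λ z → b L₂ j ≡ just z) ey by)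
      where
      ex : x' ≡ x
      ex = R₁.eB-inj (just-injective (≡tr (sym (R₁.b-sound j x' bx)) (≡tr (blueLab₁≡ j) lj)))
      ey : y' ≡ y
      ey = R₂.eB-inj (just-injective (≡tr (sym (R₂.b-sound j y' by)) (≡tr (blueLab₂≡ j) (≡tr lj (cong just eq)))))

    kerR⇒ : ∀ z z' → ιRZ z ≡ ιRZ z' → EqClosure (GenId (r L₁) (r L₂)) z z'
    kerR⇒ z z' eq with ≡tr (sym (enRZ z)) (≡tr (cong (enum sR) eq) (enRZ z'))
    kerR⇒ (inj₁ x) (inj₁ x') eq | e' with R₁.eR-inj e'
    ... | refl = ε
    kerR⇒ (inj₂ x) (inj₂ x') eq | e' with R₂.eR-inj e'
    ... | refl = ε
    kerR⇒ (inj₁ x) (inj₂ y) eq | e' = fwd (sharedR x y e') ◅ ε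
    kerR⇒ (inj₂ y) (inj₁ x) eq | e' = bwd (sharedR x y (sym e')) ◅ ε

    kerB⇒ : ∀ z z' → ιBZ z ≡ ιBZ z' → EqClosure (GenId (b L₁) (b L₂)) z z'
    kerB⇒ z z' eq with ≡tr (sym (enBZ z)) (≡tr (cong (enum sB) eq) (enBZ z'))
    kerB⇒ (inj₁ x) (inj₁ x') eq | e' with R₁.eB-inj e'
    ... | refl = ε
    kerB⇒ (inj₂ x) (inj₂ x') eq | e' with R₂.eB-inj e'
    ... | refl = ε
    kerB⇒ (inj₁ x) (inj₂ y) eq | e' = fwd (sharedB x y e') ◅ ε
    kerB⇒ (inj₂ y) (inj₁ x) eq | e' = bwd (sharedB x y (sym e')) ◅ ε

    surjR : ∀ v → (∃[ x ] (ιR₁ x ≡ v)) ⊎ (∃[ y ] (ιR₂ y ≡ v))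
    surjR v with ∨≡true⇒⊎ _ _ (≡tr (sym (reds-∪ (enum sR v))) (enum-P sR v))
    ... | inj₁ s1 with R₁.eR-sur _ s1
    ...   | x , ex = inj₁ (x , enum-injective sR (≡tr (enR₁ x) ex))
    surjR v | inj₂ s2 with R₂.eR-sur _ s2
    ...   | x , ex = inj₂ (x , enum-injective sR (≡tr (enR₂ x) ex))

    surjB : ∀ v → (∃[ x ] (ιB₁ x ≡ v)) ⊎ (∃[ y ] (ιB₂ y ≡ v))
    surjB v with ∨≡true⇒⊎ _ _ (≡tr (sym (blues-∪ (enum sB v))) (enum-P sB v))
    ... | inj₁ s1 with R₁.eB-sur _ s1
    ...   | x , ex = inj₁ (x , enum-injective sB (≡tr (enB₁ x) ex))
    surjB v | inj₂ s2 with R₂.eB-sur _ s2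
    ...   | x , ex = inj₂ (x , enum-injective sB (≡tr (enB₂ x) ex))

    edges⇒ : ∀ e v → E' (enum sB e) (enum sR v) ≡ true →
             (∃[ x ] ∃[ y ] (E (G L₁) x y ≡ true × ιB₁ x ≡ e × ιR₁ y ≡ v))
             ⊎ (∃[ x ] ∃[ y ] (E (G L₂) x y ≡ true × ιB₂ x ≡ e × ιR₂ y ≡ v))
    edges⇒ e v h with edge-within-part _ _ (enum-P sB e) (enum-P sR v) h
    ... | inj₁ (sb , sr) with R₁.eB-sur _ sb | R₁.eR-sur _ sr
    ...   | x , ex | y , ey = inj₁ (x , y , ≡tr (R₁.eE x y) (≡tr (cong₂ E' ex ey) h) ,
                                    enum-injective sB (≡tr (enB₁ x) ex) , enum-injective sR (≡tr (enR₁ y) ey))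
    edges⇒ e v h | inj₂ (sb , sr) with R₂.eB-sur _ sb | R₂.eR-sur _ sr
    ...   | x , ex | y , ey = inj₂ (x , y , ≡tr (R₂.eE x y) (≡tr (cong₂ E' ex ey) h) ,
                                    enum-injective sB (≡tr (enB₂ x) ex) , enum-injective sR (≡tr (enR₂ y) ey))

    edges⇐ : ∀ e v → ((∃[ x ] ∃[ y ] (E (G L₁) x y ≡ true × ιB₁ x ≡ e × ιR₁ y ≡ v))
             ⊎ (∃[ x ] ∃[ y ] (E (G L₂) x y ≡ true × ιB₂ x ≡ e × ιR₂ y ≡ v))) →
             E' (enum sB e) (enum sR v) ≡ true
    edges⇐ e v (inj₁ (x , y , exy , refl , refl)) = ≡tr (cong₂ E' (enB₁ x) (enR₁ y)) (≡tr (sym (R₁.eE x y)) exy)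
    edges⇐ e v (inj₂ (x , y , exy , refl , refl)) = ≡tr (cong₂ E' (enB₂ x) (enR₂ y)) (≡tr (sym (R₂.eE x y)) exy)

    mapRZ : ℕ → Maybe (Fin (card sR))
    mapRZ i = Maybe.map ιR₁ (r L₁ i) <∣> Maybe.map ιR₂ (r L₂ i)

    labR : ∀ i → mkr i ≡ mapRZ i
    labR i with r L₁ i in r1
    ... | just x with R₁.r-sound i x r1
    ...   | l1 , t1 = subst (λ i' → mkr i' ≡ just (ιR₁ x)) (≡tr (cong toℕ (enR₁ x)) t1)
                        (RR.r-complete (ιR₁ x) (subst (λ z → labReds Dt z ≡ true) (sym (enR₁ x)) (≡tr (labReds-∪ _) (∨-introˡ _ _ l1))))
    labR i | nothing with r L₂ i in r2
    ... | just y with R₂.r-sound i y r2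
    ...   | l2 , t2 = subst (λ i' → mkr i' ≡ just (ιR₂ y)) (≡tr (cong toℕ (enR₂ y)) t2)
                        (RR.r-complete (ιR₂ y) (subst (λ z → labReds Dt z ≡ true) (sym (enR₂ y)) (≡tr (labReds-∪ _) (∨-introʳ _ _ l2))))
    labR i | nothing | nothing with mkr i in mi
    ... | nothing = refl
    ... | just x with RR.r-sound i x mi
    ... | lx , tx with ∨≡true⇒⊎ _ _ (≡tr (sym (labReds-∪ _)) lx)
    ... | inj₁ l1 with R₁.eR-sur _ (R₁.labReds⊆reds _ l1)
    ...   | x1 , ex1 = ⊥-elim (just≢nothing (≡tr (sym (subst (λ i' → r L₁ i' ≡ just x1) (≡tr (cong toℕ ex1) tx)
                          (R₁.r-complete x1 (subst (λ z → labReds D₁ z ≡ true) (sym ex1) l1)))) r1))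
    labR i | nothing | nothing | just x | lx , tx | inj₂ l2 with R₂.eR-sur _ (R₂.labReds⊆reds _ l2)
    ...   | x2 , ex2 = ⊥-elim (just≢nothing (≡tr (sym (subst (λ i' → r L₂ i' ≡ just x2) (≡tr (cong toℕ ex2) tx)
                          (R₂.r-complete x2 (subst (λ z → labReds D₂ z ≡ true) (sym ex2) l2)))) r2))

    labB : ∀ j → mkb j ≡ (Maybe.map ιB₁ (b L₁ j) <∣> Maybe.map ιB₂ (b L₂ j))
    labB j = go (blueLab Dt j) refl
      where
      go : ∀ ml → blueLab Dt j ≡ ml → mkb j ≡ (Maybe.map ιB₁ (b L₁ j) <∣> Maybe.map ιB₂ (b L₂ j))
      go (just a) lj with R₁.b-complete j a (≡tr (blueLab₁≡ j) lj) | RR.b-complete j a lj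
      ... | x , bx | y , my = ≡tr my (≡tr (cong just yx) (sym (cong (λ mm → Maybe.map ιB₁ mm <∣> Maybe.map ιB₂ (b L₂ j)) bx)))
        where
        yx : y ≡ ιB₁ x
        yx = enum-injective sB (≡tr (just-injective (≡tr (sym (RR.b-sound j y my)) lj))
               (≡tr (just-injective (≡tr (sym (≡tr (blueLab₁≡ j) lj)) (R₁.b-sound j x bx))) (sym (enB₁ x))))
      go nothing lj with b L₁ j in b1 | b L₂ j in b2 | mkb j in mb
      ... | just x | _ | _ = ⊥-elim (just≢nothing (≡tr (sym (≡tr (sym (blueLab₁≡ j)) (R₁.b-sound j x b1))) lj))
      ... | nothing | just y | _ = ⊥-elim (just≢nothing (≡tr (sym (≡tr (sym (blueLab₂≡ j)) (R₂.b-sound j y b2))) lj))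
      ... | nothing | nothing | just y = ⊥-elim (just≢nothing (≡tr (sym (RR.b-sound j y mb)) lj))
      ... | nothing | nothing | nothing = refl

    labG : ∀ i → mkg i ≡ (g L₁ i <∣> g L₂ i)
    labG i = ≡tr (cong (Maybe.map (guard ∘ enum sR)) (labR i)) h
      where
      h : Maybe.map (guard ∘ enum sR) (Maybe.map ιR₁ (r L₁ i) <∣> Maybe.map ιR₂ (r L₂ i)) ≡ (g L₁ i <∣> g L₂ i)
      h with r L₁ i in r1
      ... | just x = ≡tr (cong (λ z → just (guard z)) (enR₁ x)) (sym (cong (_<∣> g L₂ i) (R₁.g-guard i x r1)))
      ... | nothing with r L₂ i in r2
      ...   | just y = ≡tr (cong (λ z → just (guard z)) (enR₂ y))
                         (sym (≡tr (cong (_<∣> g L₂ i) (is-just≡⇒nothing (domEq L₁ i) r1)) (R₂.g-guard i y r2)))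
      ...   | nothing = sym (cong₂ _<∣>_ (is-just≡⇒nothing (domEq L₁ i) r1) (is-just≡⇒nothing (domEq L₂ i) r2))

    isGlue : IsGlue L₁ L₂ built
    isGlue = record
      { ιR₁ = ιR₁ ; ιR₂ = ιR₂ ; ιB₁ = ιB₁ ; ιB₂ = ιB₂
      ; surjR = surjR ; surjB = surjB
      ; kerR = λ z z' → mk⇔ (kerR⇒ z z') starR
      ; kerB = λ z z' → mk⇔ (kerB⇒ z z') starB
      ; edges = λ e v → mk⇔ (edges⇒ e v) (edges⇐ e v)
      ; labR = labR ; labB = labB ; labG = labG }

  touches : (Fin n → Bool) → Fin m → Bool
  touches T v = anyB (λ s → T s ∧ E' s v)

  touches-elim : ∀ T v → touches T v ≡ true → ∃[ s ] (T s ≡ true × E' s v ≡ true)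
  touches-elim T v h with anyB-elim (λ s → T s ∧ E' s v) h
  ... | s , hs = s , ∧≡true⇒× _ _ hs

  touches-intro : ∀ T v s → T s ≡ true → E' s v ≡ true → touches T v ≡ true
  touches-intro T v s ts es = anyB-intro (λ s → T s ∧ E' s v) s (∧-intro ts es)

  touchesPath : Maybe (Fin n) → Fin m → Bool
  touchesPath q v = anyB (λ a → onPath q a ∧ E' a v)

  piece : Maybe (Fin n) → (Fin n → Bool) → Sketch
  piece q T = sketch (touches T) (λ x → onPath q x ∨ T x) (λ v → touches T v ∧ touchesPath q v) (pathLabel q)

  piece-wellFormed : ∀ q T → WellFormed (piece q T)
  piece-wellFormed q T = record
    { labReds⊆reds = λ v h → proj₁ (∧≡true⇒× _ _ h)
    ; blueLab⊆blues = λ j a h → ∨-introˡ _ _ (proj₁ (pathLabel-sound q j a h))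
    ; reds-covered = λ v h → let (s , ts , es) = touches-elim T v h in s , ∨-introʳ (onPath q s) _ ts , es }

  buildPiece : Maybe (Fin n) → (Fin n → Bool) → LIG k
  buildPiece q T = Build.built (piece q T) (piece-wellFormed q T)

  buildPiece-realises : ∀ q T → Realises (piece q T) (buildPiece q T)
  buildPiece-realises q T = Build.built-realises (piece q T) (piece-wellFormed q T)

  piece-ext : ∀ q T T' → (∀ x → T x ≡ T' x) → SketchEq (piece q T) (piece q T')
  piece-ext q T T' h = record
    { reds≡ = reds≡'
    ; blues≡ = λ x → cong (onPath q x ∨_) (h x)
    ; labReds≡ = λ v → cong (_∧ touchesPath q v) (reds≡' v)
    ; blueLab≡ = λ j → refl }
    where
    reds≡' : ∀ v → touches T v ≡ touches T' v
    reds≡' v = anyB-ext _ _ (λ s → cong (_∧ E' s v) (h s))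

  touches-∪ : ∀ T₁ T₂ v → touches (λ x → T₁ x ∨ T₂ x) v ≡ (touches T₁ v ∨ touches T₂ v)
  touches-∪ T₁ T₂ v = bool-ext _ _ forth back
    where
    forth : touches (λ x → T₁ x ∨ T₂ x) v ≡ true → (touches T₁ v ∨ touches T₂ v) ≡ true
    forth h with touches-elim _ v h
    ... | s , ts , es with ∨≡true⇒⊎ _ _ ts
    ... | inj₁ t1 = ∨-introˡ _ _ (touches-intro T₁ v s t1 es)
    ... | inj₂ t2 = ∨-introʳ (touches T₁ v) _ (touches-intro T₂ v s t2 es)
    back : (touches T₁ v ∨ touches T₂ v) ≡ true → touches (λ x → T₁ x ∨ T₂ x) v ≡ true
    back h with ∨≡true⇒⊎ _ _ h
    ... | inj₁ h1 = let (s , ts , es) = touches-elim T₁ v h1 in touches-intro _ v s (∨-introˡ _ _ ts) es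
    ... | inj₂ h2 = let (s , ts , es) = touches-elim T₂ v h2 in touches-intro _ v s (∨-introʳ (T₁ s) _ ts) es

  piece-glueCondition : ∀ q T₁ T₂ →
              (∀ v → touches T₁ v ≡ true → touches T₂ v ≡ true → touchesPath q v ≡ true) →
              (∀ x → T₁ x ≡ true → T₂ x ≡ true → onPath q x ≡ true) →
              GlueCondition (piece q T₁) (piece q T₂) (piece q (λ x → T₁ x ∨ T₂ x))
  piece-glueCondition q T₁ T₂ sharedReds sharedBlues = record
    { reds-∪ = touches-∪ T₁ T₂
    ; blues-∪ = λ x → ∨-distribˡ-∨ (onPath q x) (T₁ x) (T₂ x)
    ; labReds-∪ = λ v → ≡tr (cong (_∧ touchesPath q v) (touches-∪ T₁ T₂ v))
                            (∧-distribʳ-∨ (touchesPath q v) (touches T₁ v) (touches T₂ v))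
    ; blueLab₁≡ = λ j → refl
    ; blueLab₂≡ = λ j → refl
    ; sharedReds-labelled = λ v s1 s2 → ∧-intro s1 (sharedReds v s1 s2) , ∧-intro s2 (sharedReds v s1 s2)
    ; sharedBlues-labelled = sharedBlue
    ; edge-within-part = edge }
    where
    sharedBlue : ∀ a → (onPath q a ∨ T₁ a) ≡ true → (onPath q a ∨ T₂ a) ≡ true → ∃[ j ] (pathLabel q j ≡ just a)
    sharedBlue a h1 h2 = depthLabel a , pathLabel-depthLabel q a pa
      where
      pa : onPath q a ≡ true
      pa with ∨≡true⇒⊎ _ _ h1 | ∨≡true⇒⊎ _ _ h2
      ... | inj₁ p | _ = p
      ... | inj₂ _ | inj₁ p = p
      ... | inj₂ t1 | inj₂ t2 = sharedBlues a t1 t2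
    edge : ∀ a v → (onPath q a ∨ (T₁ a ∨ T₂ a)) ≡ true → touches (λ x → T₁ x ∨ T₂ x) v ≡ true →
           E' a v ≡ true →
           ((onPath q a ∨ T₁ a) ≡ true × touches T₁ v ≡ true) ⊎ ((onPath q a ∨ T₂ a) ≡ true × touches T₂ v ≡ true)
    edge a v sb sr e with ∨≡true⇒⊎ (onPath q a) _ sb
    ... | inj₁ p with ∨≡true⇒⊎ _ _ (≡tr (sym (touches-∪ T₁ T₂ v)) sr)
    ...   | inj₁ s1 = inj₁ (∨-introˡ (onPath q a) _ p , s1)
    ...   | inj₂ s2 = inj₂ (∨-introˡ (onPath q a) _ p , s2)
    edge a v sb sr e | inj₂ t with ∨≡true⇒⊎ _ _ t
    ...   | inj₁ t1 = inj₁ (∨-introʳ (onPath q a) _ t1 , touches-intro T₁ v a t1 e)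
    ...   | inj₂ t2 = inj₂ (∨-introʳ (onPath q a) _ t2 , touches-intro T₂ v a t2 e)

  Buildable : ℕ → Maybe (Fin n) → (Fin n → Bool) → Set
  Buildable i q T = ∃[ L ] (GLI k i L × Realises (piece q T) L)

  Buildable-glue : ∀ {i} q T₁ T₂ →
              (∀ v → touches T₁ v ≡ true → touches T₂ v ≡ true → touchesPath q v ≡ true) →
              (∀ x → T₁ x ≡ true → T₂ x ≡ true → onPath q x ≡ true) →
              Buildable i q T₁ → Buildable i q T₂ → Buildable i q (λ x → T₁ x ∨ T₂ x)
  Buildable-glue {i} q T₁ T₂ sharedReds sharedBlues (L₁ , d₁ , R₁) (L₂ , d₂ , R₂) =
    buildPiece q T₁₂ , subst (λ l → GLI k l (buildPiece q T₁₂)) (⊔-idem i) glued , buildPiece-realises q T₁₂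
    where
    T₁₂ : Fin n → Bool
    T₁₂ x = T₁ x ∨ T₂ x
    isGlue : IsGlue L₁ L₂ (buildPiece q T₁₂)
    isGlue = RealisesGlue.isGlue R₁ R₂ (piece-wellFormed q T₁₂) (piece-glueCondition q T₁ T₂ sharedReds sharedBlues)
    glued : GLI k (i ⊔ i) (buildPiece q T₁₂)
    glued = glue d₁ d₂ (Realises-compatible R₁ R₂) (buildPiece q T₁₂) isGlue

  Buildable-ext : ∀ {i} q T T' → (∀ x → T x ≡ T' x) → Buildable i q T → Buildable i q T'
  Buildable-ext q T T' h (L , d , R) = L , d , Realises-ext (piece-ext q T T' h) R

  fullyLabelled⇒GLI₀ : ∀ Dt L → Realises Dt L → (∀ v → reds Dt v ≡ true → labReds Dt v ≡ true) →
              (∀ a → blues Dt a ≡ true → ∃[ j ] (blueLab Dt j ≡ just a)) →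
              (∀ v → labReds Dt v ≡ true → ∃[ a ] (blueLab Dt (guard v) ≡ just a × E' a v ≡ true)) → GLI k 0 L
  fullyLabelled⇒GLI₀ Dt L R allR allB grd = base L rg redsLabelled bluesLabelled
    where
    open Realises R
    rg : RealGuards L
    rg i x rx with r-sound i x rx
    ... | lx , _ with grd (eR x) lx
    ... | a , la , ea with b-complete (guard (eR x)) a la
    ... | y , by = guard (eR x) , g-guard i x rx , y , by ,
                   ≡tr (eE y x) (subst (λ z → E' z (eR x) ≡ true) (sym (just-injective (≡tr (sym (b-sound _ y by)) la))) ea)
    redsLabelled : ∀ x → ∃[ i ] (r L i ≡ just x)
    redsLabelled x = toℕ (eR x) , r-complete x (allR _ (eR-in x))
    bluesLabelled : ∀ y → ∃[ j ] (b L j ≡ just y)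
    bluesLabelled y with allB _ (eB-in y)
    ... | j , lj with b-complete j _ lj
    ... | y' , by' = j , subst (λ z → b L j ≡ just z) (eB-inj (just-injective (≡tr (sym (b-sound j y' by')) lj))) by'

  piece-guard : ∀ q T v → labReds (piece q T) v ≡ true → ∃[ a ] (pathLabel q (guard v) ≡ just a × E' a v ≡ true)
  piece-guard q T v h with anyB-elim (λ a → onPath q a ∧ E' a v) (proj₂ (∧≡true⇒× _ _ h))
  ... | a , ha with ∧≡true⇒× _ _ ha
  ... | pa , ea = top v , pathLabel-guard q v a pa ea , top-E v


  subtree : Fin n → Fin n → Bool
  subtree c x = ancᵇ c x

  single : Maybe (Fin n) → Fin n → Bool
  single nothing x = false
  single (just t) x = does (x FinP.≟ t)

  childOfᵇ : Maybe (Fin n) → Fin n → Bool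
  childOfᵇ q c = does (_≟ᴹ_ (parent F c) q)

  childOfᵇ-sound : ∀ q c → childOfᵇ q c ≡ true → parent F c ≡ q
  childOfᵇ-sound q c h = dec-true⁻¹ (_≟ᴹ_ (parent F c) q) h

  childOfᵇ-complete : ∀ q c → parent F c ≡ q → childOfᵇ q c ≡ true
  childOfᵇ-complete q c h = dec-true (_≟ᴹ_ (parent F c) q) h

  withChildrenBelow : Maybe (Fin n) → ℕ → Fin n → Bool
  withChildrenBelow q N x = single q x ∨ anyB (λ c → does (toℕ c <? N) ∧ (childOfᵇ q c ∧ ancᵇ c x))

  withChildrenBelow-elim : ∀ q N x → withChildrenBelow q N x ≡ true →
                           single q x ≡ true ⊎ ∃[ c ] (toℕ c < N × parent F c ≡ q × Anc F c x)
  withChildrenBelow-elim q N x h with ∨≡true⇒⊎ _ _ h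
  ... | inj₁ h0 = inj₁ h0
  ... | inj₂ h1 with anyB-elim _ h1
  ... | c , hc with ∧≡true⇒× _ _ hc
  ... | h2 , h3 with ∧≡true⇒× _ _ h3
  ... | h4 , h5 = inj₂ (c , dec-true⁻¹ (toℕ c <? N) h2 , childOfᵇ-sound q c h4 , dec-true⁻¹ (Anc? c x) h5)

  withChildrenBelow-self : ∀ q N x → single q x ≡ true → withChildrenBelow q N x ≡ true
  withChildrenBelow-self q N x h = ∨-introˡ _ _ h

  withChildrenBelow-child : ∀ q N x c → toℕ c < N → parent F c ≡ q → Anc F c x → withChildrenBelow q N x ≡ true
  withChildrenBelow-child q N x c lt pc a = ∨-introʳ (single q x) _ (anyB-intro _ c
    (∧-intro (dec-true (toℕ c <? N) lt) (∧-intro (childOfᵇ-complete q c pc) (dec-true (Anc? c x) a))))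

  sibling-Anc⇒≡ : ∀ {c c'} → parent F c ≡ parent F c' → Anc F c c' → c ≡ c'
  sibling-Anc⇒≡ pe here = refl
  sibling-Anc⇒≡ {c} pe (there {q = w} e a) =
    ⊥-elim (<-irrefl refl (≤-trans (subst (suc (dep w) ≤_) (sym (depStep c w (≡tr pe e))) ≤-refl) (Anc⇒dep≤ a)))

  onPath⇒dep< : ∀ q c a → parent F c ≡ q → onPath q a ≡ true → dep a < dep c
  onPath⇒dep< nothing c a pc ()
  onPath⇒dep< (just t) c a pc pa = ≤-trans (s≤s (Anc⇒dep≤ (onPath⇒Anc t a pa))) (≤-reflexive (sym (depStep c t pc)))

  onPath-child : ∀ q c a → parent F c ≡ q → onPath q a ≡ true → onPath (just c) a ≡ true
  onPath-child nothing c a pc ()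
  onPath-child (just t) c a pc pa = Anc⇒onPath c a (Anc-trans (onPath⇒Anc t a pa) (there pc here))

  strictAnc⇒onPath-parent : ∀ q c p → Anc F p c → p ≢ c → parent F c ≡ q → onPath q p ≡ true
  strictAnc⇒onPath-parent q c p here ne _ = ⊥-elim (ne refl)
  strictAnc⇒onPath-parent nothing c p (there e a) ne pc = ⊥-elim (just≢nothing (≡tr (sym e) pc))
  strictAnc⇒onPath-parent (just t) c p (there e a) ne pc with just-injective (≡tr (sym e) pc)
  ... | refl = Anc⇒onPath _ p a

  single-disjoint : ∀ q c x → parent F c ≡ q → single q x ≡ true → ¬ Anc F c x
  single-disjoint nothing c x pc () a
  single-disjoint (just t) c x pc h a with dec-true⁻¹ (x FinP.≟ t) h
  ... | refl = <-irrefl refl (≤-trans (≤-reflexive (sym (depStep c t pc))) (Anc⇒dep≤ a))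

  withChildrenBelow-disjoint : ∀ q N c x → parent F c ≡ q → toℕ c ≡ N → withChildrenBelow q N x ≡ true → ¬ Anc F c x
  withChildrenBelow-disjoint q N c x pc tc h a with withChildrenBelow-elim q N x h
  ... | inj₁ h0 = single-disjoint q c x pc h0 a
  ... | inj₂ (c' , lt , pc' , a') with Anc-comparable a a'
  ...   | inj₁ cc' with sibling-Anc⇒≡ (≡tr pc (sym pc')) cc'
  ...     | refl = <-irrefl tc lt
  withChildrenBelow-disjoint q N c x pc tc h a | inj₂ (c' , lt , pc' , a') | inj₂ c'c with sibling-Anc⇒≡ (≡tr pc' (sym pc)) c'c
  ...     | refl = <-irrefl tc lt

  shared-red-touchesPath : ∀ q N c → parent F c ≡ q → toℕ c ≡ N → ∀ v →
                           touches (withChildrenBelow q N) v ≡ true → touches (subtree c) v ≡ true → touchesPath q v ≡ true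
  shared-red-touchesPath q N c pc tc v h1 h2 with touches-elim _ v h1 | touches-elim _ v h2
  ... | s , ts , es | s' , ds' , es' with strict s s' v es es'
  ... | c0 , (c0s , c0s' , _) , cover with cover v es es'
  ... | p , pc0 , ep with Anc-comparable (Anc-trans pc0 c0s') (dec-true⁻¹ (Anc? c s') ds')
  ...   | inj₂ cp = ⊥-elim (withChildrenBelow-disjoint q N c s pc tc ts (Anc-trans cp (Anc-trans pc0 c0s)))
  ...   | inj₁ pcc with p FinP.≟ c
  ...     | yes refl = ⊥-elim (withChildrenBelow-disjoint q N c s pc tc ts (Anc-trans pc0 c0s))
  ...     | no ne = anyB-intro _ p (∧-intro (strictAnc⇒onPath-parent q c p pcc ne pc) ep)

  withChildrenBelow-zero : ∀ q x → single q x ≡ withChildrenBelow q 0 x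
  withChildrenBelow-zero q x = bool-ext _ _ (withChildrenBelow-self q 0 x) below0
    where
    below0 : withChildrenBelow q 0 x ≡ true → single q x ≡ true
    below0 h with withChildrenBelow-elim q 0 x h
    ... | inj₁ h0 = h0

  withChildrenBelow-mono : ∀ q N x → withChildrenBelow q N x ≡ true → withChildrenBelow q (suc N) x ≡ true
  withChildrenBelow-mono q N x h with withChildrenBelow-elim q N x h
  ... | inj₁ h0 = withChildrenBelow-self q (suc N) x h0
  ... | inj₂ (c , lt , pc , a) = withChildrenBelow-child q (suc N) x c (m≤n⇒m≤1+n lt) pc a

  withChildrenBelow-suc-elim : ∀ q N x → withChildrenBelow q (suc N) x ≡ true →
                               withChildrenBelow q N x ≡ true ⊎ ∃[ c ] (toℕ c ≡ N × parent F c ≡ q × Anc F c x)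
  withChildrenBelow-suc-elim q N x h with withChildrenBelow-elim q (suc N) x h
  ... | inj₁ h0 = inj₁ (withChildrenBelow-self q N x h0)
  ... | inj₂ (c , lt , pc , a) with m≤n⇒m<n∨m≡n (s≤s⁻¹ lt)
  ...   | inj₁ lt' = inj₁ (withChildrenBelow-child q N x c lt' pc a)
  ...   | inj₂ tc = inj₂ (c , tc , pc , a)

  withChildrenBelow-suc-noChild : ∀ q N → (∀ c → toℕ c ≡ N → parent F c ≢ q) →
                                  ∀ x → withChildrenBelow q N x ≡ withChildrenBelow q (suc N) x
  withChildrenBelow-suc-noChild q N none x = bool-ext _ _ (withChildrenBelow-mono q N x) shrink
    where
    shrink : withChildrenBelow q (suc N) x ≡ true → withChildrenBelow q N x ≡ true
    shrink h with withChildrenBelow-suc-elim q N x h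
    ... | inj₁ h' = h'
    ... | inj₂ (c , tc , pc , _) = ⊥-elim (none c tc pc)

  withChildrenBelow-suc-child : ∀ q N c → toℕ c ≡ N → parent F c ≡ q →
                                ∀ x → (withChildrenBelow q N x ∨ subtree c x) ≡ withChildrenBelow q (suc N) x
  withChildrenBelow-suc-child q N c tc pc x = bool-ext _ _ grow shrink
    where
    grow : (withChildrenBelow q N x ∨ subtree c x) ≡ true → withChildrenBelow q (suc N) x ≡ true
    grow h with ∨≡true⇒⊎ _ _ h
    ... | inj₁ h' = withChildrenBelow-mono q N x h'
    ... | inj₂ d  = withChildrenBelow-child q (suc N) x c (≤-reflexive (cong suc tc)) pc (dec-true⁻¹ (Anc? c x) d)
    shrink : withChildrenBelow q (suc N) x ≡ true → (withChildrenBelow q N x ∨ subtree c x) ≡ true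
    shrink h with withChildrenBelow-suc-elim q N x h
    ... | inj₁ h' = ∨-introˡ _ _ h'
    ... | inj₂ (c' , tc' , _ , a) with FinP.toℕ-injective (≡tr tc' (sym tc))
    ...   | refl = ∨-introʳ (withChildrenBelow q N x) _ (dec-true (Anc? c x) a)

  Buildable-withChildrenBelow : ∀ q i → Buildable i q (single q) →
                                (∀ c → parent F c ≡ q → Buildable i q (subtree c)) →
                                ∀ N → Buildable i q (withChildrenBelow q N)
  Buildable-withChildrenBelow q i b-single b-child zero =
    Buildable-ext q _ _ (withChildrenBelow-zero q) b-single
  Buildable-withChildrenBelow q i b-single b-child (suc N) with N <? n
  ... | no N≮n = Buildable-ext q _ _ (withChildrenBelow-suc-noChild q N noNode) previous
    where
    noNode : ∀ c → toℕ c ≡ N → parent F c ≢ q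
    noNode c tc _ = N≮n (subst (_< n) tc (FinP.toℕ<n c))
    previous : Buildable i q (withChildrenBelow q N)
    previous = Buildable-withChildrenBelow q i b-single b-child N
  ... | yes N<n with childOfᵇ q (fromℕ< N<n) in isChild
  ...   | false = Buildable-ext q _ _ (withChildrenBelow-suc-noChild q N notChild) previous
    where
    notChild : ∀ c → toℕ c ≡ N → parent F c ≢ q
    notChild c tc pc with FinP.toℕ-injective (≡tr tc (sym (FinP.toℕ-fromℕ< N<n)))
    ... | refl = true≢false (≡tr (sym (childOfᵇ-complete q c pc)) isChild)
    previous : Buildable i q (withChildrenBelow q N)
    previous = Buildable-withChildrenBelow q i b-single b-child N
  ...   | true = Buildable-ext q _ _ (withChildrenBelow-suc-child q N c₀ tc₀ pc₀)
                   (Buildable-glue q (withChildrenBelow q N) (subtree c₀) (shared-red-touchesPath q N c₀ pc₀ tc₀)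
                      (λ x t₁ t₂ → ⊥-elim (withChildrenBelow-disjoint q N c₀ x pc₀ tc₀ t₁ (dec-true⁻¹ (Anc? c₀ x) t₂)))
                      (Buildable-withChildrenBelow q i b-single b-child N) (b-child c₀ pc₀))
    where
    c₀ : Fin n
    c₀ = fromℕ< N<n
    pc₀ : parent F c₀ ≡ q
    pc₀ = childOfᵇ-sound q c₀ isChild
    tc₀ : toℕ c₀ ≡ N
    tc₀ = FinP.toℕ-fromℕ< N<n

  touchesPath-child : ∀ q c v → parent F c ≡ q → touchesPath q v ≡ true → touchesPath (just c) v ≡ true
  touchesPath-child q c v pc h with anyB-elim _ h
  ... | a , ha with ∧≡true⇒× _ _ ha
  ... | pa , ea = anyB-intro _ a (∧-intro (onPath-child q c a pc pa) ea)

  guard≢depthLabel-child : ∀ q c v → parent F c ≡ q → touchesPath q v ≡ true → guard v ≢ depthLabel c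
  guard≢depthLabel-child q c v pc h eq with anyB-elim _ h
  ... | a , ha with ∧≡true⇒× _ _ ha
  ... | pa , ea = <-irrefl (≡tr (sym (depthLabel-suc (top v))) (≡tr (cong (suc ∘ toℕ) eq) (depthLabel-suc c)))
                    (≤-<-trans (Anc⇒dep≤ (top-anc v a ea)) (onPath⇒dep< q c a pc pa))

  pathLabel-parent : ∀ q c → parent F c ≡ q → ∀ j →
                     pathLabel q j ≡ (if does (j FinP.≟ depthLabel c) then nothing else pathLabel (just c) j)
  pathLabel-parent q c pc j with does (j FinP.≟ depthLabel c) in isLabel
  ... | true with dec-true⁻¹ (j FinP.≟ depthLabel c) isLabel
  ...   | refl with pathLabel q (depthLabel c) in lq
  ...     | nothing = refl
  ...     | just a with pathLabel-sound q _ a lq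
  ...       | pa , da = ⊥-elim (<-irrefl (≡tr da (depthLabel-suc c)) (onPath⇒dep< q c a pc pa))
  pathLabel-parent q c pc j | false = first-ext _ _ (λ a → bool-ext _ _ (narrow a) (widen a))
    where
    narrow : ∀ a → atLabelᵇ q j a ≡ true → atLabelᵇ (just c) j a ≡ true
    narrow a h with ∧≡true⇒× _ _ h
    ... | pa , da = ∧-intro (onPath-child q c a pc pa) da
    widen : ∀ a → atLabelᵇ (just c) j a ≡ true → atLabelᵇ q j a ≡ true
    widen a h with ∧≡true⇒× _ _ h
    ... | pa , da with a FinP.≟ c
    ...   | no ne = ∧-intro (strictAnc⇒onPath-parent q c a (onPath⇒Anc c a pa) ne pc) da
    ...   | yes refl = ⊥-elim (true≢false (≡tr (sym (dec-true (j FinP.≟ depthLabel a) j≡label)) isLabel))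
      where
      j≡label : j ≡ depthLabel a
      j≡label = FinP.toℕ-injective (suc-injective
                  (≡tr (sym (dec-true⁻¹ (dep a ≟ suc (toℕ j)) da)) (sym (depthLabel-suc a))))

  piece-blues-child : ∀ q c → parent F c ≡ q → ∀ x →
                      (onPath (just c) x ∨ subtree c x) ≡ (onPath q x ∨ subtree c x)
  piece-blues-child q c pc x = bool-ext _ _ narrow widen
    where
    narrow : (onPath (just c) x ∨ subtree c x) ≡ true → (onPath q x ∨ subtree c x) ≡ true
    narrow h with ∨≡true⇒⊎ _ _ h
    ... | inj₂ dx = ∨-introʳ (onPath q x) _ dx
    ... | inj₁ px with x FinP.≟ c
    ...   | yes refl = ∨-introʳ (onPath q x) _ (dec-true (Anc? x x) here)
    ...   | no ne = ∨-introˡ _ _ (strictAnc⇒onPath-parent q c x (onPath⇒Anc c x px) ne pc)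
    widen : (onPath q x ∨ subtree c x) ≡ true → (onPath (just c) x ∨ subtree c x) ≡ true
    widen h with ∨≡true⇒⊎ _ _ h
    ... | inj₂ dx = ∨-introʳ (onPath (just c) x) _ dx
    ... | inj₁ px = ∨-introˡ _ _ (onPath-child q c x pc px)

  Buildable-closeSubtree : ∀ q c → parent F c ≡ q → ∀ {i} →
                           Buildable i (just c) (subtree c) → Buildable (suc i) q (subtree c)
  Buildable-closeSubtree q c pc {i} (L , d , R) = L₂ , subst (λ l → GLI k l L₂) level d₂ , Realises-ext same Blue.realises'
    where
    keptReds : Fin m → Bool
    keptReds v = touches (subtree c) v ∧ touchesPath q v
    kept⊆ : ∀ v → keptReds v ≡ true → (touches (subtree c) v ∧ touchesPath (just c) v) ≡ true
    kept⊆ v h with ∧≡true⇒× _ _ h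
    ... | h₁ , h₂ = ∧-intro h₁ (touchesPath-child q c v pc h₂)
    module Red = RealisesRemoveRed R keptReds kept⊆
    L₁ : LIG k
    L₁ = removeRed L Red.dropped
    Y : Fin k → Bool
    Y j = does (j FinP.≟ depthLabel c)
    Y-removable : ∀ j → Y j ≡ true → InDom (b L₁) j × ¬ InImg (g L₁) j
    Y-removable j yj with dec-true⁻¹ (j FinP.≟ depthLabel c) yj
    ... | refl = labelled , unguarded
      where
      labelled : InDom (b L₁) (depthLabel c)
      labelled with Realises.b-complete R (depthLabel c) c (pathLabel-depthLabel (just c) c (Anc⇒onPath c c here))
      ... | y , by = cong is-just by
      unguarded : ¬ InImg (g L₁) (depthLabel c)
      unguarded (i₀ , gi) with is-just≡⇒just (sym (domEq L₁ i₀)) gi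
      ... | x , rx = guard≢depthLabel-child q c (Realises.eR Red.realises' x) pc
                       (proj₂ (∧≡true⇒× _ _ (proj₁ (Realises.r-sound Red.realises' i₀ x rx))))
                       (just-injective (≡tr (sym (Realises.g-guard Red.realises' i₀ x rx)) gi))
    L₂ : LIG k
    L₂ = removeBlue L₁ Y
    d₂ : GLI k (i + card Y) L₂
    d₂ = blueRem (redRem d Red.dropped Red.dropped-labelled) Y Y-removable
    level : i + card Y ≡ suc i
    level = ≡tr (cong (i +_) (card-singleton (depthLabel c))) (+-comm i 1)
    module Blue = RealisesRemoveBlue Red.realises' Y (pathLabel q) (pathLabel-parent q c pc)
    same : SketchEq Blue.Dt' (piece q (subtree c))
    same = record { reds≡ = λ _ → refl ; blues≡ = piece-blues-child q c pc
                  ; labReds≡ = λ _ → refl ; blueLab≡ = λ _ → refl }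

  withChildrenBelow-all : ∀ t x → withChildrenBelow (just t) n x ≡ subtree t x
  withChildrenBelow-all t x = bool-ext _ _ forth back
    where
    forth : withChildrenBelow (just t) n x ≡ true → subtree t x ≡ true
    forth h with withChildrenBelow-elim (just t) n x h
    ... | inj₁ h0 with dec-true⁻¹ (x FinP.≟ t) h0
    ...   | refl = dec-true (Anc? x x) here
    forth h | inj₂ (c , _ , pc , a) = dec-true (Anc? t x) (Anc-trans (there pc here) a)
    split : ∀ {y} → Anc F t y → y ≡ t ⊎ ∃[ c ] (parent F c ≡ just t × Anc F c y)
    split here = inj₁ refl
    split {y} (there e a) with split a
    ... | inj₁ refl = inj₂ (y , e , here)
    ... | inj₂ (c , pc , ac) = inj₂ (c , pc , there e ac)
    back : subtree t x ≡ true → withChildrenBelow (just t) n x ≡ true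
    back h with split (dec-true⁻¹ (Anc? t x) h)
    ... | inj₁ refl = withChildrenBelow-self (just t) n x (dec-true (x FinP.≟ x) refl)
    ... | inj₂ (c , pc , a) = withChildrenBelow-child (just t) n x c (FinP.toℕ<n c) pc a

  withChildrenBelow-roots : ∀ x → withChildrenBelow nothing n x ≡ true
  withChildrenBelow-roots x with rootAbove x
  ... | ρ , pρ , aρ = withChildrenBelow-child nothing n x ρ (FinP.toℕ<n ρ) pρ aρ

  single⇒onPath : ∀ q a → single q a ≡ true → onPath q a ≡ true
  single⇒onPath (just t) a h with dec-true⁻¹ (a FinP.≟ t) h
  ... | refl = Anc⇒onPath a a here

  single-Buildable : ∀ q i → Buildable i q (single q)
  single-Buildable q i =
    buildPiece q (single q) ,
    GLI-mono (fullyLabelled⇒GLI₀ _ _ (buildPiece-realises q (single q)) allReds allBlues (piece-guard q (single q))) z≤n ,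
    buildPiece-realises q (single q)
    where
    allReds : ∀ v → touches (single q) v ≡ true → (touches (single q) v ∧ touchesPath q v) ≡ true
    allReds v h with touches-elim _ v h
    ... | s , ts , es = ∧-intro h (anyB-intro _ s (∧-intro (single⇒onPath q s ts) es))
    allBlues : ∀ a → (onPath q a ∨ single q a) ≡ true → ∃[ j ] (pathLabel q j ≡ just a)
    allBlues a h with ∨≡true⇒⊎ _ _ h
    ... | inj₁ pa = depthLabel a , pathLabel-depthLabel q a pa
    ... | inj₂ sa = depthLabel a , pathLabel-depthLabel q a (single⇒onPath q a sa)

  mutual
    subtree-Buildable : ∀ i t → dep t + i ≡ k → Buildable i (just t) (subtree t)
    subtree-Buildable i t eq = Buildable-ext (just t) _ _ (withChildrenBelow-all t)
      (Buildable-withChildrenBelow (just t) i (single-Buildable (just t) i) (children-Buildable i t eq) n)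

    children-Buildable : ∀ i t → dep t + i ≡ k → ∀ c → parent F c ≡ just t → Buildable i (just t) (subtree c)
    children-Buildable zero t eq c pc = ⊥-elim (<-irrefl refl
      (≤-trans (≤-reflexive (sym (depStep c t pc))) (≤-trans (dep≤k c) (≤-reflexive (≡tr (sym eq) (+-identityʳ (dep t)))))))
    children-Buildable (suc i) t eq c pc = Buildable-closeSubtree (just t) c pc (subtree-Buildable i c eq')
      where
      eq' : dep c + i ≡ k
      eq' = ≡tr (cong (_+ i) (depStep c t pc)) (≡tr (sym (+-suc (dep t) i)) eq)

  forest-Buildable : 1 ≤ k → Buildable k nothing (λ _ → true)
  forest-Buildable (s≤s {n = k'} z≤n) = Buildable-ext nothing _ _ withChildrenBelow-roots
    (Buildable-withChildrenBelow nothing k (single-Buildable nothing k) roots-Buildable n)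
    where
    roots-Buildable : ∀ c → parent F c ≡ nothing → Buildable k nothing (subtree c)
    roots-Buildable c pc = Buildable-closeSubtree nothing c pc (subtree-Buildable k' c (cong (_+ k') (depRoot c pc)))

  module _ (L : LIG k) (R : Realises (piece nothing (λ _ → true)) L) where
    open Realises R

    noRedLabels : ∀ i → r L i ≡ nothing
    noRedLabels i with r L i in ri
    ... | nothing = refl
    ... | just x with anyB-elim (λ a → onPath nothing a ∧ E' a (eR x)) (proj₂ (∧≡true⇒× _ _ (proj₁ (r-sound i x ri))))
    ...   | a , ()

    noBlueLabels : ∀ j → b L j ≡ nothing
    noBlueLabels j with b L j in bj
    ... | nothing = refl
    ... | just y with pathLabel-sound nothing j (eB y) (b-sound j y bj)
    ...   | () , _

    whole-LabelFree : LabelFree L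
    whole-LabelFree = noRedLabels , noBlueLabels , λ i → is-just≡⇒nothing (domEq L i) (noRedLabels i)

    whole-Iso : Iso (G L) J
    whole-Iso = record { φR = φR ; φB = φB ; edges = eE }
      where
      allReds : ∀ v → touches (λ _ → true) v ≡ true
      allReds v = touches-intro (λ _ → true) v (proj₁ (red-covered v)) refl (proj₂ (red-covered v))
      φR : Fin (nR (G L)) ⤖ Fin (nR J)
      φR = mk⤖ {to = eR} (eR-inj , λ v → proj₁ (eR-sur v (allReds v)) , λ { refl → proj₂ (eR-sur v (allReds v)) })
      onto : ∀ e → ∃[ y ] (∀ {z} → z ≡ y → Bijection.to Γ (eB z) ≡ e)
      onto e with Γ-surjective e
      ... | s , refl with eB-sur s refl
      ...   | y , refl = y , λ { refl → refl }
      φB : Fin (nB (G L)) ⤖ Fin (nB J)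
      φB = mk⤖ {to = λ y → Bijection.to Γ (eB y)} ((λ h → eB-inj (Γ-injective h)) , onto)

  completeness : 1 ≤ k → ∃[ L ] (GLI^ k L × LabelFree L × Iso (G L) J)
  completeness k≥1 with forest-Buildable k≥1
  ... | L , L∈GLI , R = L , L∈GLI , whole-LabelFree L R , whole-Iso L R

theorem4p1 : (k : ℕ) → 1 ≤ k → (J : IG) →
    shd≤ J k ⇔ (∃[ L ] (GLI^ k L × LabelFree L × Iso (G L) J))
theorem4p1 k k≥1 J = mk⇔ complete sound
  where
  complete : shd≤ J k → ∃[ L ] (GLI^ k L × LabelFree L × Iso (G L) J)
  complete (SF , height≤k) = Completeness.completeness J SF height≤k k≥1
  sound : ∃[ L ] (GLI^ k L × LabelFree L × Iso (G L) J) → shd≤ J k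
  sound (L , L∈GLI , labelFree , iso) =
    shd≤-Iso iso (labelFree⇒shd≤ L labelFree (proj₂ (gli⇒LabelledElimForest L∈GLI)))
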